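{- If $p$ is a prime number with $p\geq 7$, then \[ B^{(-p+3)}_{p-3}\equiv 0\pmod{p}. \]
   Context: For any integer $k$, let $\mathrm{Li}_k(t)=\sum_{n\geq 1} t^n/n^k$ (for $k\le 0$ this is a rational function of $t$). The poly-Bernoulli numbers $B^{(k)}_n$ ($n\geq 0$) are defined by \[ \frac{\mathrm{Li}_{k}(1-e^{ -t})}{1-e^{ -t}}=\sum_{n=0}^{\infty}B^{(k)}_{n}\frac{t^n}{n!}. \] For negative upper index these are positive integers. -}

module Defs where

open import Data.Nat as ℕ using (ℕ; zero; suc)
open import Data.Nat.Base using (_!)
open import Data.Nat.Properties using (_!≢0)
open import Data.Integer as ℤ using (ℤ)
open import Data.Rational using (ℚ; _/_; _+_; _*_; -_; 0ℚ; 1ℚ)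
open import Data.Fin using (Fin; toℕ)

FPS : Set
FPS = ℕ → ℚ

Σ≤ : ℕ → (ℕ → ℚ) → ℚ
Σ≤ zero    f = f zero
Σ≤ (suc n) f = Σ≤ n f + f (suc n)

_⊛_ : FPS → FPS → FPS
(f ⊛ g) n = Σ≤ n (λ i → f i * g (n ℕ.∸ i))

pow : FPS → ℕ → FPS
pow f zero    zero    = 1ℚ
pow f zero    (suc _) = 0ℚ
pow f (suc m) = f ⊛ pow f m

oneMinusExpNeg : FPS
oneMinusExpNeg zero = 0ℚ
oneMinusExpNeg (suc n) = sgn n * (ℤ.+ 1 / (suc n) !)
  where
    instance _ = (suc n) !≢0
    sgn : ℕ → ℚ
    sgn zero = 1ℚ
    sgn (suc k) = - sgn k

-- For k ≥ 0:  Li_{-k}(x) / x = Σ_{m≥0} (m+1)^k x^m.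
-- Since u(t) has zero constant term, the coefficient of t^n in
-- Li_{-k}(u(t))/u(t) = Σ_m (m+1)^k u(t)^m only involves m ≤ n.
-- This is the coefficient of t^n in  Li_{-k}(1-e^{-t})/(1-e^{-t}).
genCoeff : ℕ → ℕ → ℚ
genCoeff k n = Σ≤ n (λ m → ((ℤ.+ ((suc m) ℕ.^ k)) / 1) * pow oneMinusExpNeg m n)

polyBernoulliNeg : ℕ → ℕ → ℚ
polyBernoulliNeg k n = ((ℤ.+ (n !)) / 1) * genCoeff k n

{-# OPTIONS --safe #-}

-- Let n = p − 3, let uPow m n = n! [tⁿ] (1 − e^{−t})ᵐ, so that B = B_n^{(−n)} = ∑ₘ (m+1)ⁿ uPow m n,
-- and let H(M), H₂(M) be the harmonic numbers of order 1 and 2, all sums over 1 ≤ M ≤ p − 1 and all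
-- congruences modulo p. There (m+1)ⁿ ≡ 1/(m+1)², and the recursion coming from
-- (u^{m+1})′ = (m+1) uᵐ (1 − u), together with Fermat's little theorem, gives uPow M (p−2) ≡ H(M) and
-- uPow M n ≡ uPow (M−1) n − H(M)/M. Summation by parts then yields B ≡ ∑ H(M) H₂(M) / M, while the
-- Arakawa–Kaneko formula B = ∑ⱼ (j! S(p−2, j+1))² with j! S(p−2, j+1) ≡ ±H(j+1)/(j+1) yields
-- B ≡ ∑ H(M)² / M². Telescoping H(M)² H₂(M) expresses ∑ H(M)²/M² + 2 ∑ H(M) H₂(M) / M through
-- ∑ H(M)/M³, ∑ H₂(M)/M² and ∑ 1/M⁴, which vanish by the symmetry M ↦ p − M, by telescoping, and
-- because ∑ Mᵉ ≡ 0 for 0 < e < p − 1 (here p ≥ 7 is needed). Hence 3B ≡ 0.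

module Submission where

open import Defs

import Algebra.Definitions.RawSemiring as RawSemiringDefinitions
import Algebra.Properties.CommutativeSemiring.Binomial as CommutativeSemiringBinomial
import Algebra.Properties.CommutativeSemiring.Exp as CommutativeSemiringExp
import Algebra.Properties.Semiring.Sum as SemiringSum
open import Data.Fin using (toℕ)
open import Data.Fin.Properties using (toℕ<n)
open import Data.Integer as ℤ using (ℤ; +_; 0ℤ; 1ℤ; -1ℤ; _+_; _*_; -_; _-_; _^_)
open import Data.Integer.Divisibility.Signed using (_∣_; divides; ∣m∣n⇒∣m+n; ∣m⇒∣-m; ∣n⇒∣m*n; ∣⇒∣ᵤ; ∣ᵤ⇒∣)
import Data.Integer.Properties as ℤP
open import Data.Integer.Tactic.RingSolver using (solve-∀)
open import Data.Nat as ℕ using (ℕ; zero; suc; _∸_; _!; _<_; _≤_)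
open import Data.Nat.Combinatorics using (_C_; nCn≡1; nCk≡n!/k![n-k]!; k>n⇒nCk≡0; k![n∸k]!∣n!; nCk+nC[k+1]≡[n+1]C[k+1])
import Data.Nat.Divisibility as ℕDiv
open import Data.Nat.DivMod using (m/n*n≡m)
open import Data.Nat.Primality using (Prime; euclidsLemma)
import Data.Nat.Properties as ℕP
open import Data.Nat.Properties using (_!≢0)
import Data.Nat.Tactic.RingSolver as ℕSolver
open import Data.Product using (∃; _,_; proj₁; proj₂)
open import Data.Rational as ℚ using (ℚ; _/_; 1ℚ; toℚᵘ)
import Data.Rational.Properties as ℚP
import Data.Rational.Solver as ℚSolver
import Data.Rational.Unnormalised as ℚᵘ
import Data.Rational.Unnormalised.Properties as ℚᵘP
open import Data.Sum using (inj₁; inj₂)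
open import Function using (_∘_)
open import Level using (0ℓ)
open import Relation.Binary.Bundles using (Setoid)
open import Relation.Binary.PropositionalEquality
import Relation.Binary.Reasoning.Setoid as SetoidReasoning
open import Relation.Nullary using (contradiction)

private
  module ℤSum = SemiringSum ℤP.+-*-semiring
  module ℤBinomial = CommutativeSemiringBinomial ℤP.+-*-commutativeSemiring
  module ℤSemiring = RawSemiringDefinitions ℤ.+-*-rawSemiring
  module ℤExp = CommutativeSemiringExp ℤP.+-*-commutativeSemiring

  y≡x-[x-y] : ∀ x y → y ≡ x - (x - y)
  y≡x-[x-y] = solve-∀

  x≡x+y-y : ∀ x y → x ≡ x + y - y
  x≡x+y-y = solve-∀

module Sums where

  open ≡-Reasoning

  -- Computes from the head: ∑ (suc n) f reduces to f 0 + ∑ n (f ∘ suc).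
  ∑ : ℕ → (ℕ → ℤ) → ℤ
  ∑ n f = ℤSum.sum {n} (f ∘ toℕ)

  syntax ∑ n (λ i → e) = ∑[ i < n ] e

  ∑-cong : ∀ n {f g : ℕ → ℤ} → (∀ {i} → i < n → f i ≡ g i) → ∑ n f ≡ ∑ n g
  ∑-cong n f≗g = ℤSum.sum-cong-≗ (λ i → f≗g (toℕ<n i))

  ∑-distrib-+ : ∀ n (f g : ℕ → ℤ) → ∑[ i < n ] (f i + g i) ≡ ∑ n f + ∑ n g
  ∑-distrib-+ n f g = ℤSum.∑-distrib-+ {n} (f ∘ toℕ) (g ∘ toℕ)

  *-distribˡ-∑ : ∀ n c (f : ℕ → ℤ) → c * ∑ n f ≡ ∑[ i < n ] (c * f i)
  *-distribˡ-∑ n c f = ℤSum.*-distribˡ-sum {n} c (f ∘ toℕ)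

  ∑-comm : ∀ m n (f : ℕ → ℕ → ℤ) → ∑[ i < m ] ∑[ j < n ] f i j ≡ ∑[ j < n ] ∑[ i < m ] f i j
  ∑-comm m n f = ℤSum.∑-comm {m} {n} (λ i j → f (toℕ i) (toℕ j))

  ∑-comm-* : ∀ m n (a b : ℕ → ℤ) (c : ℕ → ℕ → ℤ) →
             ∑[ j < m ] (a j * ∑[ i < n ] (b i * c j i)) ≡ ∑[ i < n ] (b i * ∑[ j < m ] (a j * c j i))
  ∑-comm-* m n a b c = begin
    ∑[ j < m ] (a j * ∑[ i < n ] (b i * c j i))     ≡⟨ ∑-cong m (λ {j} _ → *-distribˡ-∑ n (a j) (λ i → b i * c j i)) ⟩
    ∑[ j < m ] ∑[ i < n ] (a j * (b i * c j i))     ≡⟨ ∑-cong m (λ {j} _ → ∑-cong n (λ {i} _ → swap (a j) (b i) (c j i))) ⟩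
    ∑[ j < m ] ∑[ i < n ] (b i * (a j * c j i))     ≡⟨ ∑-comm m n (λ j i → b i * (a j * c j i)) ⟩
    ∑[ i < n ] ∑[ j < m ] (b i * (a j * c j i))     ≡⟨ ∑-cong n (λ {i} _ → *-distribˡ-∑ m (b i) (λ j → a j * c j i)) ⟨
    ∑[ i < n ] (b i * ∑[ j < m ] (a j * c j i))     ∎
    where
    swap : ∀ x y z → x * (y * z) ≡ y * (x * z)
    swap = solve-∀

  ∑-zero : ∀ n → ∑[ i < n ] 0ℤ ≡ 0ℤ
  ∑-zero n = ℤSum.sum-replicate-zero n

  neg-distrib-∑ : ∀ n (f : ℕ → ℤ) → - ∑ n f ≡ ∑[ i < n ] (- f i)
  neg-distrib-∑ n f = begin
    - ∑ n f                  ≡⟨ ℤP.-1*i≡-i (∑ n f) ⟨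
    -1ℤ * ∑ n f              ≡⟨ *-distribˡ-∑ n -1ℤ f ⟩
    ∑[ i < n ] (-1ℤ * f i)   ≡⟨ ∑-cong n (λ {i} _ → ℤP.-1*i≡-i (f i)) ⟩
    ∑[ i < n ] (- f i)       ∎

  ∑-distrib-- : ∀ n (f g : ℕ → ℤ) → ∑[ i < n ] (f i - g i) ≡ ∑ n f - ∑ n g
  ∑-distrib-- n f g = trans (∑-distrib-+ n f (-_ ∘ g)) (cong (_+_ (∑ n f)) (sym (neg-distrib-∑ n g)))

  ∑-last : ∀ n (f : ℕ → ℤ) → ∑ (suc n) f ≡ ∑ n f + f n
  ∑-last zero    f = ℤP.+-comm (f 0) 0ℤ
  ∑-last (suc n) f = begin
    f 0 + ∑ (suc n) (f ∘ suc)         ≡⟨ cong (_+_ (f 0)) (∑-last n (f ∘ suc)) ⟩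
    f 0 + (∑ n (f ∘ suc) + f (suc n)) ≡⟨ ℤP.+-assoc (f 0) _ _ ⟨
    ∑ (suc n) f + f (suc n)           ∎

  ∑-last-zero : ∀ n (f : ℕ → ℤ) → f n ≡ 0ℤ → ∑ (suc n) f ≡ ∑ n f
  ∑-last-zero n f fn≡0 = trans (∑-last n f) (trans (cong (_+_ (∑ n f)) fn≡0) (ℤP.+-identityʳ (∑ n f)))

  ∑-telescope : ∀ n (a : ℕ → ℤ) → ∑[ i < n ] (a (suc i) - a i) ≡ a n - a 0
  ∑-telescope zero    a = sym (ℤP.+-inverseʳ (a 0))
  ∑-telescope (suc n) a = begin
    (a 1 - a 0) + ∑[ i < n ] (a (suc (suc i)) - a (suc i)) ≡⟨ cong (_+_ (a 1 - a 0)) (∑-telescope n (a ∘ suc)) ⟩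
    (a 1 - a 0) + (a (suc n) - a 1)                         ≡⟨ chain (a 0) (a 1) (a (suc n)) ⟩
    a (suc n) - a 0                                         ∎
    where
    chain : ∀ x y z → (y - x) + (z - y) ≡ z - x
    chain = solve-∀

  ∑-reverse : ∀ n (f : ℕ → ℤ) → ∑ n f ≡ ∑[ i < n ] f (n ∸ suc i)
  ∑-reverse zero    f = refl
  ∑-reverse (suc n) f = begin
    f 0 + ∑ n (f ∘ suc)                         ≡⟨ cong (_+_ (f 0)) (∑-reverse n (f ∘ suc)) ⟩
    f 0 + ∑[ i < n ] f (suc (n ∸ suc i))        ≡⟨ cong₂ _+_ (cong f (sym (ℕP.n∸n≡0 n))) (∑-cong n shift) ⟩
    f (n ∸ n) + ∑[ i < n ] f (n ∸ i)            ≡⟨ ℤP.+-comm (f (n ∸ n)) _ ⟩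
    ∑[ i < n ] f (n ∸ i) + f (n ∸ n)            ≡⟨ ∑-last n (λ i → f (n ∸ i)) ⟨
    ∑[ i < suc n ] f (suc n ∸ suc i)            ∎
    where
    shift : ∀ {i} → i < n → f (suc (n ∸ suc i)) ≡ f (n ∸ i)
    shift i<n = cong f (sym (ℕP.+-∸-assoc 1 i<n))

open Sums

module Powers where

  open ≡-Reasoning

  ×≡* : ∀ n x → n ℤSemiring.× x ≡ + n * x
  ×≡* zero    x = sym (ℤP.*-zeroˡ x)
  ×≡* (suc n) x = begin
    x + n ℤSemiring.× x   ≡⟨ cong (_+_ x) (×≡* n x) ⟩
    x + + n * x           ≡⟨ cong (_+ + n * x) (ℤP.*-identityˡ x) ⟨
    1ℤ * x + + n * x      ≡⟨ ℤP.*-distribʳ-+ x 1ℤ (+ n) ⟨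
    (1ℤ + + n) * x        ∎

  ^≡^ : ∀ x n → x ℤSemiring.^ n ≡ x ^ n
  ^≡^ x zero    = refl
  ^≡^ x (suc n) = cong (x *_) (^≡^ x n)

  ^-distribʳ-* : ∀ x y n → (x * y) ^ n ≡ x ^ n * y ^ n
  ^-distribʳ-* x y n = begin
    (x * y) ^ n                             ≡⟨ ^≡^ (x * y) n ⟨
    (x * y) ℤSemiring.^ n                   ≡⟨ ℤExp.^-distrib-* x y n ⟩
    x ℤSemiring.^ n * y ℤSemiring.^ n       ≡⟨ cong₂ _*_ (^≡^ x n) (^≡^ y n) ⟩
    x ^ n * y ^ n                           ∎

  neg-^ : ∀ x n → (- x) ^ n ≡ -1ℤ ^ n * x ^ n
  neg-^ x n = trans (cong (_^ n) (sym (ℤP.-1*i≡-i x))) (^-distribʳ-* -1ℤ x n)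

  -1^n*-1^n≡1 : ∀ n → -1ℤ ^ n * -1ℤ ^ n ≡ 1ℤ
  -1^n*-1^n≡1 n = trans (sym (^-distribʳ-* -1ℤ -1ℤ n)) (ℤP.^-zeroˡ n)

  pos-^ : ∀ a k → + (a ℕ.^ k) ≡ (+ a) ^ k
  pos-^ a zero    = refl
  pos-^ a (suc k) = trans (ℤP.pos-* a (a ℕ.^ k)) (cong (+ a *_) (pos-^ a k))

open Powers

module Binomials where

  open ≡-Reasoning

  nCk*k!*[n∸k]!≡n! : ∀ {n k} → k ≤ n → (n C k) ℕ.* (k ! ℕ.* (n ∸ k) !) ≡ n !
  nCk*k!*[n∸k]!≡n! {n} {k} k≤n = begin
    (n C k) ℕ.* (k ! ℕ.* (n ∸ k) !)                         ≡⟨ cong (ℕ._* (k ! ℕ.* (n ∸ k) !)) (nCk≡n!/k![n-k]! k≤n) ⟩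
    (n ! ℕ./ (k ! ℕ.* (n ∸ k) !)) ℕ.* (k ! ℕ.* (n ∸ k) !) ≡⟨ m/n*n≡m (k![n∸k]!∣n! k≤n) ⟩
    n !                                                   ∎
    where instance _ = k ℕP.!* (n ∸ k) !≢0

  absorption : ∀ m k → suc k ℕ.* (suc m C suc k) ≡ suc m ℕ.* (m C k)
  absorption m k with ℕP.≤-<-connex k m
  ... | inj₂ m<k rewrite k>n⇒nCk≡0 m<k | k>n⇒nCk≡0 (ℕ.s<s m<k) = trans (ℕP.*-zeroʳ (suc k)) (sym (ℕP.*-zeroʳ (suc m)))
  ... | inj₁ k≤m = ℕP.*-cancelʳ-≡ _ _ (k ! ℕ.* (m ∸ k) !) {{k ℕP.!* (m ∸ k) !≢0}} (begin
    suc k ℕ.* (suc m C suc k) ℕ.* (k ! ℕ.* (m ∸ k) !) ≡⟨ regroup (suc k) (suc m C suc k) (k !) ((m ∸ k) !) ⟩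
    (suc m C suc k) ℕ.* (suc k ! ℕ.* (m ∸ k) !)         ≡⟨ nCk*k!*[n∸k]!≡n! (ℕ.s≤s k≤m) ⟩
    suc m !                                            ≡⟨ cong (suc m ℕ.*_) (nCk*k!*[n∸k]!≡n! k≤m) ⟨
    suc m ℕ.* ((m C k) ℕ.* (k ! ℕ.* (m ∸ k) !))         ≡⟨ ℕP.*-assoc (suc m) (m C k) _ ⟨
    suc m ℕ.* (m C k) ℕ.* (k ! ℕ.* (m ∸ k) !)         ∎)
    where
    regroup : ∀ a b c d → a ℕ.* b ℕ.* (c ℕ.* d) ≡ b ℕ.* (a ℕ.* c ℕ.* d)
    regroup = ℕSolver.solve-∀

  absorption-ℤ : ∀ m j → + suc j * + (suc m C suc j) ≡ + suc m * + (m C j)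
  absorption-ℤ m j = trans (sym (ℤP.pos-* (suc j) _)) (trans (cong +_ (absorption m j)) (ℤP.pos-* (suc m) _))

  pascal-ℤ : ∀ m j → + (suc m C suc j) ≡ + (m C j) + + (m C suc j)
  pascal-ℤ m j = trans (cong +_ (sym (nCk+nC[k+1]≡[n+1]C[k+1] m j))) (ℤP.pos-+ (m C j) (m C suc j))

  [1+m]*mCj≡[1+j]*[mCj+mC[1+j]] : ∀ m j → + suc m * + (m C j) ≡ + suc j * (+ (m C j) + + (m C suc j))
  [1+m]*mCj≡[1+j]*[mCj+mC[1+j]] m j = trans (sym (absorption-ℤ m j)) (cong (+ suc j *_) (pascal-ℤ m j))

  binomial-theorem : ∀ n x y → (x + y) ^ n ≡ ∑[ k < suc n ] (+ (n C k) * (x ^ k * y ^ (n ∸ k)))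
  binomial-theorem n x y = begin
    (x + y) ^ n                ≡⟨ ^≡^ (x + y) n ⟨
    (x + y) ℤSemiring.^ n      ≡⟨ ℤBinomial.theorem n x y ⟩
    ℤBinomial.binomialExpansion x y n ≡⟨ ∑-cong (suc n) (λ {k} _ → term k) ⟩
    ∑[ k < suc n ] (+ (n C k) * (x ^ k * y ^ (n ∸ k))) ∎
    where
    term : ∀ k → (n C k) ℤSemiring.× (x ℤSemiring.^ k * y ℤSemiring.^ (n ∸ k)) ≡ + (n C k) * (x ^ k * y ^ (n ∸ k))
    term k = trans (×≡* (n C k) _) (cong (λ z → + (n C k) * z) (cong₂ _*_ (^≡^ x k) (^≡^ y (n ∸ k))))

  binomialTransform : ℕ → (ℕ → ℤ) → ℤ
  binomialTransform m f = ∑[ j < suc m ] (+ (m C j) * f j)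

  binomialTransform-suc : ∀ m (f : ℕ → ℤ) →
    binomialTransform (suc m) f ≡ binomialTransform m f + binomialTransform m (f ∘ suc)
  binomialTransform-suc m f = begin
    + 1 * f 0 + ∑[ j < suc m ] (+ (suc m C suc j) * f (suc j))
      ≡⟨ cong (_+_ (+ 1 * f 0)) (∑-cong (suc m) (λ {j} _ → split j)) ⟩
    + 1 * f 0 + ∑[ j < suc m ] (+ (m C j) * f (suc j) + + (m C suc j) * f (suc j))
      ≡⟨ cong (_+_ (+ 1 * f 0)) (∑-distrib-+ (suc m) (λ j → + (m C j) * f (suc j)) (λ j → + (m C suc j) * f (suc j))) ⟩
    + 1 * f 0 + (binomialTransform m (f ∘ suc) + ∑[ j < suc m ] (+ (m C suc j) * f (suc j)))
      ≡⟨ swap (+ 1 * f 0) (binomialTransform m (f ∘ suc)) (∑[ j < suc m ] (+ (m C suc j) * f (suc j))) ⟩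
    ∑[ j < suc (suc m) ] (+ (m C j) * f j) + binomialTransform m (f ∘ suc)
      ≡⟨ cong (_+ binomialTransform m (f ∘ suc)) (∑-last-zero (suc m) (λ j → + (m C j) * f j) top) ⟩
    binomialTransform m f + binomialTransform m (f ∘ suc) ∎
    where
    split : ∀ j → + (suc m C suc j) * f (suc j) ≡ + (m C j) * f (suc j) + + (m C suc j) * f (suc j)
    split j = trans (cong (_* f (suc j)) (pascal-ℤ m j)) (ℤP.*-distribʳ-+ (f (suc j)) (+ (m C j)) (+ (m C suc j)))
    swap : ∀ a b c → a + (b + c) ≡ a + c + b
    swap = solve-∀
    top : + (m C suc m) * f (suc m) ≡ 0ℤ
    top = trans (cong (λ c → + c * f (suc m)) (k>n⇒nCk≡0 (ℕP.n<1+n m))) (ℤP.*-zeroˡ (f (suc m)))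

open Binomials

module ExponentialCoefficients where

  open ≡-Reasoning

  -- n! [tⁿ] u(t)ᵐ for u(t) = 1 − e^{−t}, read off from u(t)ᵐ = ∑ⱼ (−1)ʲ C(m,j) e^{−jt}.
  uPow : ℕ → ℕ → ℤ
  uPow m n = binomialTransform m (λ j → -1ℤ ^ j * (- + j) ^ n)

  -- n! [tⁿ] u(t)ᵐ e^{−t}
  uPowExp : ℕ → ℕ → ℤ
  uPowExp m n = binomialTransform m (λ j → -1ℤ ^ j * (- + suc j) ^ n)

  uPow-suc : ∀ m n → uPow (suc m) n ≡ uPow m n - uPowExp m n
  uPow-suc m n = begin
    uPow (suc m) n
      ≡⟨ binomialTransform-suc m (λ j → -1ℤ ^ j * (- + j) ^ n) ⟩
    uPow m n + binomialTransform m (λ j → -1ℤ ^ suc j * (- + suc j) ^ n)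
      ≡⟨ cong (_+_ (uPow m n)) (∑-cong (suc m) (λ {j} _ → pull-sign (+ (m C j)) (-1ℤ ^ j) ((- + suc j) ^ n))) ⟩
    uPow m n + ∑[ j < suc m ] (- (+ (m C j) * (-1ℤ ^ j * (- + suc j) ^ n)))
      ≡⟨ cong (_+_ (uPow m n)) (neg-distrib-∑ (suc m) (λ j → + (m C j) * (-1ℤ ^ j * (- + suc j) ^ n))) ⟨
    uPow m n - uPowExp m n ∎
    where
    pull-sign : ∀ c s x → c * (-1ℤ * s * x) ≡ - (c * (s * x))
    pull-sign = solve-∀

  uPow-suc-suc : ∀ m n → uPow (suc m) (suc n) ≡ + suc m * uPowExp m n
  uPow-suc-suc m n = begin
    uPow (suc m) (suc n)
      ≡⟨ ℤP.+-identityˡ _ ⟩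
    ∑[ j < suc m ] (+ (suc m C suc j) * (-1ℤ ^ suc j * (- + suc j) ^ suc n))
      ≡⟨ ∑-cong (suc m) (λ {j} _ → term j) ⟩
    ∑[ j < suc m ] (+ suc m * (+ (m C j) * (-1ℤ ^ j * (- + suc j) ^ n)))
      ≡⟨ *-distribˡ-∑ (suc m) (+ suc m) (λ j → + (m C j) * (-1ℤ ^ j * (- + suc j) ^ n)) ⟨
    + suc m * uPowExp m n ∎
    where
    regroup : ∀ c s a x → c * (-1ℤ * s * ((- a) * x)) ≡ (a * c) * (s * x)
    regroup = solve-∀
    term : ∀ j → + (suc m C suc j) * (-1ℤ ^ suc j * (- + suc j) ^ suc n) ≡ + suc m * (+ (m C j) * (-1ℤ ^ j * (- + suc j) ^ n))
    term j = begin
      + (suc m C suc j) * (-1ℤ * -1ℤ ^ j * ((- + suc j) * (- + suc j) ^ n))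
        ≡⟨ regroup (+ (suc m C suc j)) (-1ℤ ^ j) (+ suc j) ((- + suc j) ^ n) ⟩
      (+ suc j * + (suc m C suc j)) * (-1ℤ ^ j * (- + suc j) ^ n)
        ≡⟨ cong (_* (-1ℤ ^ j * (- + suc j) ^ n)) (absorption-ℤ m j) ⟩
      (+ suc m * + (m C j)) * (-1ℤ ^ j * (- + suc j) ^ n)
        ≡⟨ ℤP.*-assoc (+ suc m) (+ (m C j)) _ ⟩
      + suc m * (+ (m C j) * (-1ℤ ^ j * (- + suc j) ^ n)) ∎

  uPowExp≡uPow-uPow : ∀ m n → uPowExp m n ≡ uPow m n - uPow (suc m) n
  uPowExp≡uPow-uPow m n = trans (y≡x-[x-y] (uPow m n) (uPowExp m n)) (cong (_-_ (uPow m n)) (sym (uPow-suc m n)))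

  -- (u^{m+1})′ = (m+1) uᵐ (1 − u), since u′ = e^{−t} = 1 − u.
  uPow-derivative : ∀ m n → uPow (suc m) (suc n) ≡ + suc m * (uPow m n - uPow (suc m) n)
  uPow-derivative m n = trans (uPow-suc-suc m n) (cong (+ suc m *_) (uPowExp≡uPow-uPow m n))

  uPow-vanish : ∀ {m n} → n < m → uPow m n ≡ 0ℤ
  uPow-vanish {suc m} {zero}  _ = trans (uPow-suc m 0) (ℤP.+-inverseʳ (uPow m 0))
  uPow-vanish {suc m} {suc n} (ℕ.s<s n<m) = begin
    uPow (suc m) (suc n)                   ≡⟨ uPow-derivative m n ⟩
    + suc m * (uPow m n - uPow (suc m) n)  ≡⟨ cong₂ (λ a b → + suc m * (a - b)) (uPow-vanish n<m) (uPow-vanish (ℕP.m<n⇒m<1+n n<m)) ⟩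
    + suc m * 0ℤ                           ≡⟨ ℤP.*-zeroʳ (+ suc m) ⟩
    0ℤ                                     ∎

  uPow-one : ∀ i → uPow 1 i ≡ 0ℤ ^ i - -1ℤ ^ i
  uPow-one i = unfold (0ℤ ^ i) (-1ℤ ^ i)
    where
    unfold : ∀ a b → + 1 * (1ℤ * a) + (+ 1 * (-1ℤ * 1ℤ * b) + 0ℤ) ≡ a - b
    unfold = solve-∀

  ∑-uPow-one : ∀ n x → ∑[ i < suc n ] (+ (n C i) * uPow 1 i * x ^ (n ∸ i)) ≡ x ^ n - (-1ℤ + x) ^ n
  ∑-uPow-one n x = begin
    ∑[ i < suc n ] (+ (n C i) * uPow 1 i * x ^ (n ∸ i))
      ≡⟨ ∑-cong (suc n) (λ {i} _ → split i) ⟩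
    ∑[ i < suc n ] (+ (n C i) * (0ℤ ^ i * x ^ (n ∸ i)) - + (n C i) * (-1ℤ ^ i * x ^ (n ∸ i)))
      ≡⟨ ∑-distrib-- (suc n) (λ i → + (n C i) * (0ℤ ^ i * x ^ (n ∸ i))) (λ i → + (n C i) * (-1ℤ ^ i * x ^ (n ∸ i))) ⟩
    ∑[ i < suc n ] (+ (n C i) * (0ℤ ^ i * x ^ (n ∸ i))) - ∑[ i < suc n ] (+ (n C i) * (-1ℤ ^ i * x ^ (n ∸ i)))
      ≡⟨ cong₂ _-_ (binomial-theorem n 0ℤ x) (binomial-theorem n -1ℤ x) ⟨
    (0ℤ + x) ^ n - (-1ℤ + x) ^ n
      ≡⟨ cong (λ y → y ^ n - (-1ℤ + x) ^ n) (ℤP.+-identityˡ x) ⟩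
    x ^ n - (-1ℤ + x) ^ n ∎
    where
    distribute : ∀ c a b y → c * (a - b) * y ≡ c * (a * y) - c * (b * y)
    distribute = solve-∀
    split : ∀ i → + (n C i) * uPow 1 i * x ^ (n ∸ i) ≡ + (n C i) * (0ℤ ^ i * x ^ (n ∸ i)) - + (n C i) * (-1ℤ ^ i * x ^ (n ∸ i))
    split i = trans (cong (λ u → + (n C i) * u * x ^ (n ∸ i)) (uPow-one i)) (distribute (+ (n C i)) (0ℤ ^ i) (-1ℤ ^ i) (x ^ (n ∸ i)))

  -- The coefficient form of u^{m+1} = u · uᵐ.
  uPow-suc-Cauchy : ∀ m n → uPow (suc m) n ≡ ∑[ i < suc n ] (+ (n C i) * (uPow 1 i * uPow m (n ∸ i)))
  uPow-suc-Cauchy m n = begin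
    uPow (suc m) n
      ≡⟨ uPow-suc m n ⟩
    uPow m n - uPowExp m n
      ≡⟨ ∑-distrib-- (suc m) (λ j → + (m C j) * (-1ℤ ^ j * (- + j) ^ n)) (λ j → + (m C j) * (-1ℤ ^ j * (- + suc j) ^ n)) ⟨
    ∑[ j < suc m ] (+ (m C j) * (-1ℤ ^ j * (- + j) ^ n) - + (m C j) * (-1ℤ ^ j * (- + suc j) ^ n))
      ≡⟨ ∑-cong (suc m) (λ {j} _ → factor j) ⟩
    ∑[ j < suc m ] (a j * ∑[ i < suc n ] (b i * (- + j) ^ (n ∸ i)))
      ≡⟨ ∑-comm-* (suc m) (suc n) a b (λ j i → (- + j) ^ (n ∸ i)) ⟩
    ∑[ i < suc n ] (b i * ∑[ j < suc m ] (a j * (- + j) ^ (n ∸ i)))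
      ≡⟨ ∑-cong (suc n) (λ {i} _ → regroup i) ⟩
    ∑[ i < suc n ] (+ (n C i) * (uPow 1 i * uPow m (n ∸ i))) ∎
    where
    a b : ℕ → ℤ
    a j = + (m C j) * -1ℤ ^ j
    b i = + (n C i) * uPow 1 i
    pull : ∀ c s x y → c * (s * x) - c * (s * y) ≡ c * s * (x - y)
    pull = solve-∀
    neg-suc : ∀ j → -1ℤ + - + j ≡ - + suc j
    neg-suc j = trans (sym (ℤP.neg-distrib-+ 1ℤ (+ j))) (cong -_ (sym (ℤP.pos-+ 1 j)))
    factor : ∀ j → + (m C j) * (-1ℤ ^ j * (- + j) ^ n) - + (m C j) * (-1ℤ ^ j * (- + suc j) ^ n)
                 ≡ a j * ∑[ i < suc n ] (b i * (- + j) ^ (n ∸ i))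
    factor j = begin
      + (m C j) * (-1ℤ ^ j * (- + j) ^ n) - + (m C j) * (-1ℤ ^ j * (- + suc j) ^ n)
        ≡⟨ pull (+ (m C j)) (-1ℤ ^ j) ((- + j) ^ n) ((- + suc j) ^ n) ⟩
      a j * ((- + j) ^ n - (- + suc j) ^ n)
        ≡⟨ cong (λ y → a j * ((- + j) ^ n - y ^ n)) (neg-suc j) ⟨
      a j * ((- + j) ^ n - (-1ℤ + - + j) ^ n)
        ≡⟨ cong (a j *_) (∑-uPow-one n (- + j)) ⟨
      a j * ∑[ i < suc n ] (b i * (- + j) ^ (n ∸ i)) ∎
    regroup : ∀ i → b i * ∑[ j < suc m ] (a j * (- + j) ^ (n ∸ i)) ≡ + (n C i) * (uPow 1 i * uPow m (n ∸ i))
    regroup i = trans (cong (b i *_) (∑-cong (suc m) (λ {j} _ → ℤP.*-assoc (+ (m C j)) (-1ℤ ^ j) ((- + j) ^ (n ∸ i)))))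
                      (ℤP.*-assoc (+ (n C i)) (uPow 1 i) (uPow m (n ∸ i)))

open ExponentialCoefficients

module StirlingCoefficients where

  open ≡-Reasoning

  -- j! S(n+1, j+1), with S the Stirling numbers of the second kind.
  factorialStirling : ℕ → ℕ → ℤ
  factorialStirling zero    zero    = 1ℤ
  factorialStirling zero    (suc j) = 0ℤ
  factorialStirling (suc n) zero    = factorialStirling n zero
  factorialStirling (suc n) (suc j) = + suc (suc j) * factorialStirling n (suc j) + + suc j * factorialStirling n j

  factorialStirling-vanish : ∀ {n j} → n < j → factorialStirling n j ≡ 0ℤ
  factorialStirling-vanish {zero}  {suc j} _ = refl
  factorialStirling-vanish {suc n} {suc j} (ℕ.s<s n<j) = begin
    + suc (suc j) * factorialStirling n (suc j) + + suc j * factorialStirling n j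
      ≡⟨ cong₂ (λ a b → + suc (suc j) * a + + suc j * b) (factorialStirling-vanish (ℕP.m<n⇒m<1+n n<j)) (factorialStirling-vanish n<j) ⟩
    + suc (suc j) * 0ℤ + + suc j * 0ℤ
      ≡⟨ cong₂ _+_ (ℤP.*-zeroʳ (+ suc (suc j))) (ℤP.*-zeroʳ (+ suc j)) ⟩
    0ℤ ∎

  pow-binomialBasis : ∀ m k → (+ suc m) ^ k ≡ ∑[ j < suc k ] (factorialStirling k j * + (m C j))
  pow-binomialBasis m zero    = refl
  pow-binomialBasis m (suc k) = begin
    + suc m * (+ suc m) ^ k
      ≡⟨ cong (+ suc m *_) (pow-binomialBasis m k) ⟩
    + suc m * ∑[ j < suc k ] (A j * b j)
      ≡⟨ *-distribˡ-∑ (suc k) (+ suc m) (λ j → A j * b j) ⟩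
    ∑[ j < suc k ] (+ suc m * (A j * b j))
      ≡⟨ ∑-cong (suc k) (λ {j} _ → raise j) ⟩
    ∑[ j < suc k ] (+ suc j * A j * b j + + suc j * A j * b (suc j))
      ≡⟨ ∑-distrib-+ (suc k) (λ j → + suc j * A j * b j) (λ j → + suc j * A j * b (suc j)) ⟩
    ∑[ j < suc k ] (+ suc j * A j * b j) + ∑[ j < suc k ] (+ suc j * A j * b (suc j))
      ≡⟨ cong (_+ ∑[ j < suc k ] (+ suc j * A j * b (suc j))) diagonal ⟨
    A 0 * b 0 + ∑[ j < suc k ] (+ suc (suc j) * A (suc j) * b (suc j)) + ∑[ j < suc k ] (+ suc j * A j * b (suc j))
      ≡⟨ ℤP.+-assoc (A 0 * b 0) _ _ ⟩
    A 0 * b 0 + (∑[ j < suc k ] (+ suc (suc j) * A (suc j) * b (suc j)) + ∑[ j < suc k ] (+ suc j * A j * b (suc j)))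
      ≡⟨ cong (_+_ (A 0 * b 0)) (∑-distrib-+ (suc k) (λ j → + suc (suc j) * A (suc j) * b (suc j)) (λ j → + suc j * A j * b (suc j))) ⟨
    A 0 * b 0 + ∑[ j < suc k ] (+ suc (suc j) * A (suc j) * b (suc j) + + suc j * A j * b (suc j))
      ≡⟨ cong (_+_ (A 0 * b 0)) (∑-cong (suc k) (λ {j} _ → ℤP.*-distribʳ-+ (b (suc j)) (+ suc (suc j) * A (suc j)) (+ suc j * A j))) ⟨
    ∑[ j < suc (suc k) ] (factorialStirling (suc k) j * b j) ∎
    where
    A : ℕ → ℤ
    A = factorialStirling k
    b : ℕ → ℤ
    b j = + (m C j)
    raise : ∀ j → + suc m * (A j * b j) ≡ + suc j * A j * b j + + suc j * A j * b (suc j)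
    raise j = begin
      + suc m * (A j * b j)                   ≡⟨ swap (+ suc m) (A j) (b j) ⟩
      A j * (+ suc m * b j)                   ≡⟨ cong (A j *_) ([1+m]*mCj≡[1+j]*[mCj+mC[1+j]] m j) ⟩
      A j * (+ suc j * (b j + b (suc j)))     ≡⟨ distribute (A j) (+ suc j) (b j) (b (suc j)) ⟩
      + suc j * A j * b j + + suc j * A j * b (suc j) ∎
      where
      swap : ∀ c a x → c * (a * x) ≡ a * (c * x)
      swap = solve-∀
      distribute : ∀ a c x y → a * (c * (x + y)) ≡ c * a * x + c * a * y
      distribute = solve-∀
    diagonal : A 0 * b 0 + ∑[ j < suc k ] (+ suc (suc j) * A (suc j) * b (suc j)) ≡ ∑[ j < suc k ] (+ suc j * A j * b j)
    diagonal = begin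
      A 0 * b 0 + ∑[ j < suc k ] (+ suc (suc j) * A (suc j) * b (suc j))
        ≡⟨ cong (λ a → a * b 0 + ∑[ j < suc k ] (+ suc (suc j) * A (suc j) * b (suc j))) (ℤP.*-identityˡ (A 0)) ⟨
      ∑[ j < suc (suc k) ] (+ suc j * A j * b j)
        ≡⟨ ∑-last-zero (suc k) (λ j → + suc j * A j * b j) top ⟩
      ∑[ j < suc k ] (+ suc j * A j * b j) ∎
      where
      top : + suc (suc k) * A (suc k) * b (suc k) ≡ 0ℤ
      top rewrite factorialStirling-vanish (ℕP.n<1+n k) | ℤP.*-zeroʳ (+ suc (suc k)) = ℤP.*-zeroˡ (b (suc k))

  ∑-uPow-C-suc : ∀ n j → ∑[ m < suc (suc n) ] (uPow m (suc n) * + (m C j))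
                       ≡ ∑[ m < suc n ] (uPow m n * (+ suc m * + (suc m C j) - + m * + (m C j)))
  ∑-uPow-C-suc n j = begin
    0ℤ + ∑[ m < suc n ] (uPow (suc m) (suc n) * + (suc m C j))
      ≡⟨ ℤP.+-identityˡ _ ⟩
    ∑[ m < suc n ] (uPow (suc m) (suc n) * + (suc m C j))
      ≡⟨ ∑-cong (suc n) (λ {m} _ → cong (_* + (suc m C j)) (uPow-derivative m n)) ⟩
    ∑[ m < suc n ] (+ suc m * (uPow m n - uPow (suc m) n) * + (suc m C j))
      ≡⟨ ∑-cong (suc n) (λ {m} _ → expand (+ suc m) (uPow m n) (uPow (suc m) n) (+ (suc m C j))) ⟩
    ∑[ m < suc n ] (G m - F (suc m))
      ≡⟨ ∑-distrib-- (suc n) G (F ∘ suc) ⟩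
    ∑ (suc n) G - ∑ (suc n) (F ∘ suc)
      ≡⟨ cong (_-_ (∑ (suc n) G)) shift ⟩
    ∑ (suc n) G - ∑ (suc n) F
      ≡⟨ ∑-distrib-- (suc n) G F ⟨
    ∑[ m < suc n ] (G m - F m)
      ≡⟨ ∑-cong (suc n) (λ {m} _ → collect (+ suc m) (uPow m n) (+ (suc m C j)) (+ m) (+ (m C j))) ⟩
    ∑[ m < suc n ] (uPow m n * (+ suc m * + (suc m C j) - + m * + (m C j))) ∎
    where
    F G : ℕ → ℤ
    F m = + m * uPow m n * + (m C j)
    G m = + suc m * uPow m n * + (suc m C j)
    expand : ∀ c x y b → c * (x - y) * b ≡ c * x * b - c * y * b
    expand = solve-∀
    collect : ∀ c x b d e → c * x * b - d * x * e ≡ x * (c * b - d * e)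
    collect = solve-∀
    shift : ∑ (suc n) (F ∘ suc) ≡ ∑ (suc n) F
    shift = begin
      ∑ (suc n) (F ∘ suc)      ≡⟨ ℤP.+-identityˡ _ ⟨
      ∑ (suc (suc n)) F        ≡⟨ ∑-last-zero (suc n) F top ⟩
      ∑ (suc n) F              ∎
      where
      top : F (suc n) ≡ 0ℤ
      top rewrite uPow-vanish (ℕP.n<1+n n) | ℤP.*-zeroʳ (+ suc n) = ℤP.*-zeroˡ (+ (suc n C j))

  ∑-uPow-C : ∀ n j → ∑[ m < suc n ] (uPow m n * + (m C j)) ≡ factorialStirling n j
  ∑-uPow-C zero    zero    = refl
  ∑-uPow-C zero    (suc j) = refl
  ∑-uPow-C (suc n) zero    = begin
    ∑[ m < suc (suc n) ] (uPow m (suc n) * 1ℤ)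
      ≡⟨ ∑-uPow-C-suc n 0 ⟩
    ∑[ m < suc n ] (uPow m n * (+ suc m * 1ℤ - + m * 1ℤ))
      ≡⟨ ∑-cong (suc n) (λ {m} _ → cong (uPow m n *_) (difference (+ m))) ⟩
    ∑[ m < suc n ] (uPow m n * 1ℤ)
      ≡⟨ ∑-uPow-C n 0 ⟩
    factorialStirling n 0 ∎
    where
    difference : ∀ x → (1ℤ + x) * 1ℤ - x * 1ℤ ≡ 1ℤ
    difference = solve-∀
  ∑-uPow-C (suc n) (suc j) = begin
    ∑[ m < suc (suc n) ] (uPow m (suc n) * + (m C suc j))
      ≡⟨ ∑-uPow-C-suc n (suc j) ⟩
    ∑[ m < suc n ] (uPow m n * (+ suc m * + (suc m C suc j) - + m * + (m C suc j)))
      ≡⟨ ∑-cong (suc n) (λ {m} _ → term m) ⟩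
    ∑[ m < suc n ] (+ suc (suc j) * (uPow m n * + (m C suc j)) + + suc j * (uPow m n * + (m C j)))
      ≡⟨ ∑-distrib-+ (suc n) (λ m → + suc (suc j) * (uPow m n * + (m C suc j))) (λ m → + suc j * (uPow m n * + (m C j))) ⟩
    ∑[ m < suc n ] (+ suc (suc j) * (uPow m n * + (m C suc j))) + ∑[ m < suc n ] (+ suc j * (uPow m n * + (m C j)))
      ≡⟨ cong₂ _+_ (*-distribˡ-∑ (suc n) (+ suc (suc j)) (λ m → uPow m n * + (m C suc j)))
                   (*-distribˡ-∑ (suc n) (+ suc j) (λ m → uPow m n * + (m C j))) ⟨
    + suc (suc j) * ∑[ m < suc n ] (uPow m n * + (m C suc j)) + + suc j * ∑[ m < suc n ] (uPow m n * + (m C j))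
      ≡⟨ cong₂ (λ a b → + suc (suc j) * a + + suc j * b) (∑-uPow-C n (suc j)) (∑-uPow-C n j) ⟩
    factorialStirling (suc n) (suc j) ∎
    where
    coefficient : ∀ m → + suc m * + (suc m C suc j) - + m * + (m C suc j) ≡ + suc (suc j) * + (m C suc j) + + suc j * + (m C j)
    coefficient m = begin
      + suc m * + (suc m C suc j) - + m * + (m C suc j)
        ≡⟨ cong (λ c → + suc m * c - + m * + (m C suc j)) (pascal-ℤ m j) ⟩
      + suc m * (+ (m C j) + + (m C suc j)) - + m * + (m C suc j)
        ≡⟨ regroup (+ m) (+ (m C j)) (+ (m C suc j)) ⟩
      + suc m * + (m C j) + + (m C suc j)
        ≡⟨ cong (_+ + (m C suc j)) ([1+m]*mCj≡[1+j]*[mCj+mC[1+j]] m j) ⟩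
      + suc j * (+ (m C j) + + (m C suc j)) + + (m C suc j)
        ≡⟨ regroup′ (+ j) (+ (m C j)) (+ (m C suc j)) ⟩
      (1ℤ + (1ℤ + + j)) * + (m C suc j) + (1ℤ + + j) * + (m C j) ∎
      where
      regroup : ∀ x a b → (1ℤ + x) * (a + b) - x * b ≡ (1ℤ + x) * a + b
      regroup = solve-∀
      regroup′ : ∀ x a b → (1ℤ + x) * (a + b) + b ≡ (1ℤ + (1ℤ + x)) * b + (1ℤ + x) * a
      regroup′ = solve-∀
    term : ∀ m → uPow m n * (+ suc m * + (suc m C suc j) - + m * + (m C suc j))
               ≡ + suc (suc j) * (uPow m n * + (m C suc j)) + + suc j * (uPow m n * + (m C j))
    term m = trans (cong (uPow m n *_) (coefficient m)) (distribute (uPow m n) (+ suc (suc j)) (+ (m C suc j)) (+ suc j) (+ (m C j)))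
      where
      distribute : ∀ e a x c y → e * (a * x + c * y) ≡ a * (e * x) + c * (e * y)
      distribute = solve-∀

  factorialStirling-uPow : ∀ n j → + suc j * factorialStirling n j ≡ -1ℤ ^ (n ℕ.+ j) * uPow (suc j) (suc n)
  factorialStirling-uPow zero    zero    = refl
  factorialStirling-uPow zero    (suc j) = begin
    + suc (suc j) * 0ℤ                      ≡⟨ ℤP.*-zeroʳ (+ suc (suc j)) ⟩
    0ℤ                                      ≡⟨ ℤP.*-zeroʳ (-1ℤ ^ suc j) ⟨
    -1ℤ ^ suc j * 0ℤ                        ≡⟨ cong (-1ℤ ^ suc j *_) (uPow-vanish {suc (suc j)} {1} (ℕ.s<s ℕ.z<s)) ⟨
    -1ℤ ^ suc j * uPow (suc (suc j)) 1      ∎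
  factorialStirling-uPow (suc n) zero    = begin
    1ℤ * factorialStirling n 0                            ≡⟨ factorialStirling-uPow n 0 ⟩
    -1ℤ ^ (n ℕ.+ 0) * uPow 1 (suc n)                      ≡⟨ flip-sign (-1ℤ ^ (n ℕ.+ 0)) (uPow 1 (suc n)) ⟩
    -1ℤ * -1ℤ ^ (n ℕ.+ 0) * (1ℤ * (0ℤ - uPow 1 (suc n)))  ≡⟨ cong (-1ℤ ^ suc (n ℕ.+ 0) *_) (uPow-derivative 0 (suc n)) ⟨
    -1ℤ ^ suc (n ℕ.+ 0) * uPow 1 (suc (suc n))            ∎
    where
    flip-sign : ∀ s x → s * x ≡ -1ℤ * s * (1ℤ * (0ℤ - x))
    flip-sign = solve-∀
  factorialStirling-uPow (suc n) (suc j) = begin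
    + suc (suc j) * (+ suc (suc j) * factorialStirling n (suc j) + + suc j * factorialStirling n j)
      ≡⟨ cong (λ x → + suc (suc j) * x) (ℤP.+-comm (+ suc (suc j) * factorialStirling n (suc j)) _) ⟩
    + suc (suc j) * (+ suc j * factorialStirling n j + + suc (suc j) * factorialStirling n (suc j))
      ≡⟨ cong₂ (λ a b → + suc (suc j) * (a + b)) (factorialStirling-uPow n j) (factorialStirling-uPow n (suc j)) ⟩
    + suc (suc j) * (s * uPow (suc j) (suc n) + -1ℤ ^ (n ℕ.+ suc j) * uPow (suc (suc j)) (suc n))
      ≡⟨ cong (λ e → + suc (suc j) * (s * uPow (suc j) (suc n) + -1ℤ ^ e * uPow (suc (suc j)) (suc n))) (ℕP.+-suc n j) ⟩
    + suc (suc j) * (s * uPow (suc j) (suc n) + -1ℤ * s * uPow (suc (suc j)) (suc n))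
      ≡⟨ factor (+ suc (suc j)) s (uPow (suc j) (suc n)) (uPow (suc (suc j)) (suc n)) ⟩
    -1ℤ * (-1ℤ * s) * (+ suc (suc j) * (uPow (suc j) (suc n) - uPow (suc (suc j)) (suc n)))
      ≡⟨ cong₂ (λ e x → -1ℤ * -1ℤ ^ e * x) (ℕP.+-suc n j) (uPow-derivative (suc j) (suc n)) ⟨
    -1ℤ ^ (suc n ℕ.+ suc j) * uPow (suc (suc j)) (suc (suc n)) ∎
    where
    s : ℤ
    s = -1ℤ ^ (n ℕ.+ j)
    factor : ∀ c s x y → c * (s * x + -1ℤ * s * y) ≡ -1ℤ * (-1ℤ * s) * (c * (x - y))
    factor = solve-∀

  polyBernoulliℤ : ℕ → ℕ → ℤ
  polyBernoulliℤ k n = ∑[ m < suc n ] ((+ suc m) ^ k * uPow m n)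

  polyBernoulliℤ-closedForm : ∀ k n → polyBernoulliℤ k n ≡ ∑[ j < suc k ] (factorialStirling k j * factorialStirling n j)
  polyBernoulliℤ-closedForm k n = begin
    ∑[ m < suc n ] ((+ suc m) ^ k * uPow m n)
      ≡⟨ ∑-cong (suc n) (λ {m} _ → trans (ℤP.*-comm ((+ suc m) ^ k) (uPow m n)) (cong (uPow m n *_) (pow-binomialBasis m k))) ⟩
    ∑[ m < suc n ] (uPow m n * ∑[ j < suc k ] (factorialStirling k j * + (m C j)))
      ≡⟨ ∑-comm-* (suc n) (suc k) (λ m → uPow m n) (factorialStirling k) (λ m j → + (m C j)) ⟩
    ∑[ j < suc k ] (factorialStirling k j * ∑[ m < suc n ] (uPow m n * + (m C j)))
      ≡⟨ ∑-cong (suc k) (λ {j} _ → cong (factorialStirling k j *_) (∑-uPow-C n j)) ⟩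
    ∑[ j < suc k ] (factorialStirling k j * factorialStirling n j) ∎

open StirlingCoefficients

module RationalEmbedding where

  open ≡-Reasoning

  ⟦_⟧ : ℤ → ℚ
  ⟦ a ⟧ = a / 1

  private
    toℚᵘ-⟦⟧ : ∀ a → toℚᵘ ⟦ a ⟧ ℚᵘ.≃ ℚᵘ.mkℚᵘ a 0
    toℚᵘ-⟦⟧ a = ℚP.toℚᵘ-fromℚᵘ (ℚᵘ.mkℚᵘ a 0)

  ⟦⟧-+ : ∀ a b → ⟦ a + b ⟧ ≡ ⟦ a ⟧ ℚ.+ ⟦ b ⟧
  ⟦⟧-+ a b = ℚP.toℚᵘ-injective (ℚᵘP.≃-trans (toℚᵘ-⟦⟧ (a + b)) (ℚᵘP.≃-trans (ℚᵘ.*≡* (cross-multiplied a b))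
    (ℚᵘP.≃-sym (ℚᵘP.≃-trans (ℚP.toℚᵘ-homo-+ ⟦ a ⟧ ⟦ b ⟧) (ℚᵘP.+-cong (toℚᵘ-⟦⟧ a) (toℚᵘ-⟦⟧ b))))))
    where
    cross-multiplied : ∀ a b → (a + b) * 1ℤ ≡ (a * 1ℤ + b * 1ℤ) * 1ℤ
    cross-multiplied = solve-∀

  ⟦⟧-* : ∀ a b → ⟦ a * b ⟧ ≡ ⟦ a ⟧ ℚ.* ⟦ b ⟧
  ⟦⟧-* a b = ℚP.toℚᵘ-injective (ℚᵘP.≃-trans (toℚᵘ-⟦⟧ (a * b)) (ℚᵘP.≃-trans (ℚᵘ.*≡* refl)
    (ℚᵘP.≃-sym (ℚᵘP.≃-trans (ℚP.toℚᵘ-homo-* ⟦ a ⟧ ⟦ b ⟧) (ℚᵘP.*-cong (toℚᵘ-⟦⟧ a) (toℚᵘ-⟦⟧ b))))))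

  ⟦⟧-neg : ∀ a → ⟦ - a ⟧ ≡ ℚ.- ⟦ a ⟧
  ⟦⟧-neg a = ℚP.toℚᵘ-injective (ℚᵘP.≃-trans (toℚᵘ-⟦⟧ (- a))
    (ℚᵘP.≃-sym (ℚᵘP.≃-trans (ℚP.toℚᵘ-homo‿- ⟦ a ⟧) (ℚᵘP.-‿cong (toℚᵘ-⟦⟧ a)))))

  1/n*n≡1 : ∀ n .{{_ : ℕ.NonZero n}} → (+ 1 / n) ℚ.* ⟦ + n ⟧ ≡ 1ℚ
  1/n*n≡1 (suc n) = ℚP.toℚᵘ-injective (ℚᵘP.≃-trans (ℚP.toℚᵘ-homo-* (+ 1 / suc n) ⟦ + suc n ⟧)
    (ℚᵘP.≃-trans (ℚᵘP.*-cong (ℚP.toℚᵘ-fromℚᵘ (ℚᵘ.mkℚᵘ (+ 1) n)) (toℚᵘ-⟦⟧ (+ suc n))) (ℚᵘ.*≡* (cancel n))))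
    where
    cancel : ∀ n → (1ℤ * + suc n) * 1ℤ ≡ 1ℤ * + (suc n ℕ.* 1)
    cancel n = trans (ℤP.*-identityʳ _) (trans (ℤP.*-identityˡ _) (sym (trans (ℤP.*-identityˡ _) (cong +_ (ℕP.*-identityʳ (suc n))))))

  Σ≤-cong : ∀ n {f g : ℕ → ℚ} → (∀ {i} → i ≤ n → f i ≡ g i) → Σ≤ n f ≡ Σ≤ n g
  Σ≤-cong zero    f≗g = f≗g ℕ.z≤n
  Σ≤-cong (suc n) f≗g = cong₂ ℚ._+_ (Σ≤-cong n (λ i≤n → f≗g (ℕP.m≤n⇒m≤1+n i≤n))) (f≗g ℕP.≤-refl)

  Σ≤-*ʳ : ∀ n (f : ℕ → ℚ) c → Σ≤ n f ℚ.* c ≡ Σ≤ n (λ i → f i ℚ.* c)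
  Σ≤-*ʳ zero    f c = refl
  Σ≤-*ʳ (suc n) f c = trans (ℚP.*-distribʳ-+ c (Σ≤ n f) (f (suc n))) (cong (ℚ._+ (f (suc n) ℚ.* c)) (Σ≤-*ʳ n f c))

  Σ≤-⟦⟧ : ∀ n (t : ℕ → ℤ) → Σ≤ n (λ i → ⟦ t i ⟧) ≡ ⟦ ∑ (suc n) t ⟧
  Σ≤-⟦⟧ zero    t = cong ⟦_⟧ (sym (ℤP.+-identityʳ (t 0)))
  Σ≤-⟦⟧ (suc n) t = begin
    Σ≤ n (λ i → ⟦ t i ⟧) ℚ.+ ⟦ t (suc n) ⟧   ≡⟨ cong (ℚ._+ ⟦ t (suc n) ⟧) (Σ≤-⟦⟧ n t) ⟩
    ⟦ ∑ (suc n) t ⟧ ℚ.+ ⟦ t (suc n) ⟧        ≡⟨ ⟦⟧-+ (∑ (suc n) t) (t (suc n)) ⟨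
    ⟦ ∑ (suc n) t + t (suc n) ⟧              ≡⟨ cong ⟦_⟧ (∑-last (suc n) t) ⟨
    ⟦ ∑ (suc (suc n)) t ⟧                    ∎

  -- Defs writes the signs of the coefficients of 1 − e^{−t} with a local function that cannot be
  -- named here. The metavariable sign is solved by the otherwise unused oneMinusExpNeg-sign, whose
  -- with-abstraction turns its defining equation into a pattern unification problem.
  private mutual
    sign : ℕ → ℕ → ℚ
    sign = _

    oneMinusExpNeg-sign : ∀ m → oneMinusExpNeg (suc (suc m)) ≡ ℚ.- sign (suc m) m ℚ.* ((+ 1 / suc (suc m) !) {{suc (suc m) !≢0}})
    oneMinusExpNeg-sign m with suc m | ℚ._*_ | ℚ.-_
    ... | _ | _ | _ = refl

  private
    sign≡⟦-1^k⟧ : ∀ a k → sign a k ≡ ⟦ -1ℤ ^ k ⟧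
    sign≡⟦-1^k⟧ a zero    = refl
    sign≡⟦-1^k⟧ a (suc k) = begin
      ℚ.- sign a k              ≡⟨ cong ℚ.-_ (sign≡⟦-1^k⟧ a k) ⟩
      ℚ.- ⟦ -1ℤ ^ k ⟧           ≡⟨ ⟦⟧-neg (-1ℤ ^ k) ⟨
      ⟦ - (-1ℤ ^ k) ⟧           ≡⟨ cong ⟦_⟧ (ℤP.-1*i≡-i (-1ℤ ^ k)) ⟨
      ⟦ -1ℤ ^ suc k ⟧           ∎

  oneMinusExpNeg-coefficient : ∀ i → oneMinusExpNeg i ℚ.* ⟦ + (i !) ⟧ ≡ ⟦ uPow 1 i ⟧
  oneMinusExpNeg-coefficient zero    = ℚP.*-zeroˡ ⟦ 1ℤ ⟧
  oneMinusExpNeg-coefficient (suc k) = begin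
    sign k k ℚ.* (+ 1 / suc k !) ℚ.* ⟦ + (suc k !) ⟧     ≡⟨ ℚP.*-assoc (sign k k) _ _ ⟩
    sign k k ℚ.* ((+ 1 / suc k !) ℚ.* ⟦ + (suc k !) ⟧)   ≡⟨ cong (sign k k ℚ.*_) (1/n*n≡1 (suc k !)) ⟩
    sign k k ℚ.* 1ℚ                                       ≡⟨ ℚP.*-identityʳ (sign k k) ⟩
    sign k k                                              ≡⟨ sign≡⟦-1^k⟧ k k ⟩
    ⟦ -1ℤ ^ k ⟧                                           ≡⟨ cong ⟦_⟧ (as-uPow-one (-1ℤ ^ k)) ⟩
    ⟦ 0ℤ ^ suc k - -1ℤ ^ suc k ⟧                          ≡⟨ cong ⟦_⟧ (uPow-one (suc k)) ⟨
    ⟦ uPow 1 (suc k) ⟧                                    ∎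
    where
    instance _ = suc k !≢0
    as-uPow-one : ∀ s → s ≡ 0ℤ * (0ℤ ^ k) - -1ℤ * s
    as-uPow-one s = sym (trans (cong (_- -1ℤ * s) (ℤP.*-zeroˡ (0ℤ ^ k))) (trans (ℤP.+-identityˡ _) (trans (cong -_ (ℤP.-1*i≡-i s)) (ℤP.neg-involutive s))))

  ⟦n!⟧≡⟦nCk⟧*⟦k!⟧*⟦[n∸k]!⟧ : ∀ {n k} → k ≤ n → ⟦ + (n !) ⟧ ≡ ⟦ + (n C k) ⟧ ℚ.* (⟦ + (k !) ⟧ ℚ.* ⟦ + ((n ∸ k) !) ⟧)
  ⟦n!⟧≡⟦nCk⟧*⟦k!⟧*⟦[n∸k]!⟧ {n} {k} k≤n = begin
    ⟦ + (n !) ⟧                                             ≡⟨ cong (⟦_⟧ ∘ +_) (nCk*k!*[n∸k]!≡n! k≤n) ⟨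
    ⟦ + ((n C k) ℕ.* (k ! ℕ.* (n ∸ k) !)) ⟧                 ≡⟨ cong ⟦_⟧ (trans (ℤP.pos-* (n C k) _) (cong (+ (n C k) *_) (ℤP.pos-* (k !) _))) ⟩
    ⟦ + (n C k) * (+ (k !) * + ((n ∸ k) !)) ⟧               ≡⟨ ⟦⟧-* (+ (n C k)) (+ (k !) * + ((n ∸ k) !)) ⟩
    ⟦ + (n C k) ⟧ ℚ.* ⟦ + (k !) * + ((n ∸ k) !) ⟧           ≡⟨ cong (⟦ + (n C k) ⟧ ℚ.*_) (⟦⟧-* (+ (k !)) (+ ((n ∸ k) !))) ⟩
    ⟦ + (n C k) ⟧ ℚ.* (⟦ + (k !) ⟧ ℚ.* ⟦ + ((n ∸ k) !) ⟧)   ∎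

  pow-coefficient : ∀ m n → pow oneMinusExpNeg m n ℚ.* ⟦ + (n !) ⟧ ≡ ⟦ uPow m n ⟧
  pow-coefficient zero    zero    = refl
  pow-coefficient zero    (suc n) = ℚP.*-zeroˡ ⟦ + (suc n !) ⟧
  pow-coefficient (suc m) n = begin
    Σ≤ n (λ i → oneMinusExpNeg i ℚ.* pow oneMinusExpNeg m (n ∸ i)) ℚ.* ⟦ + (n !) ⟧
      ≡⟨ Σ≤-*ʳ n (λ i → oneMinusExpNeg i ℚ.* pow oneMinusExpNeg m (n ∸ i)) ⟦ + (n !) ⟧ ⟩
    Σ≤ n (λ i → oneMinusExpNeg i ℚ.* pow oneMinusExpNeg m (n ∸ i) ℚ.* ⟦ + (n !) ⟧)
      ≡⟨ Σ≤-cong n term ⟩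
    Σ≤ n (λ i → ⟦ + (n C i) * (uPow 1 i * uPow m (n ∸ i)) ⟧)
      ≡⟨ Σ≤-⟦⟧ n (λ i → + (n C i) * (uPow 1 i * uPow m (n ∸ i))) ⟩
    ⟦ ∑[ i < suc n ] (+ (n C i) * (uPow 1 i * uPow m (n ∸ i))) ⟧
      ≡⟨ cong ⟦_⟧ (uPow-suc-Cauchy m n) ⟨
    ⟦ uPow (suc m) n ⟧ ∎
    where
    regroup : ∀ (u v c x y : ℚ) → u ℚ.* v ℚ.* (c ℚ.* (x ℚ.* y)) ≡ c ℚ.* ((u ℚ.* x) ℚ.* (v ℚ.* y))
    regroup = QS.solve 5 (λ u v c x y → (u QS.:* v) QS.:* (c QS.:* (x QS.:* y)) QS.:= c QS.:* ((u QS.:* x) QS.:* (v QS.:* y))) refl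
      where module QS = ℚSolver.+-*-Solver
    term : ∀ {i} → i ≤ n → oneMinusExpNeg i ℚ.* pow oneMinusExpNeg m (n ∸ i) ℚ.* ⟦ + (n !) ⟧
                         ≡ ⟦ + (n C i) * (uPow 1 i * uPow m (n ∸ i)) ⟧
    term {i} i≤n = begin
      oneMinusExpNeg i ℚ.* pow oneMinusExpNeg m (n ∸ i) ℚ.* ⟦ + (n !) ⟧
        ≡⟨ cong (oneMinusExpNeg i ℚ.* pow oneMinusExpNeg m (n ∸ i) ℚ.*_) (⟦n!⟧≡⟦nCk⟧*⟦k!⟧*⟦[n∸k]!⟧ i≤n) ⟩
      oneMinusExpNeg i ℚ.* pow oneMinusExpNeg m (n ∸ i) ℚ.* (⟦ + (n C i) ⟧ ℚ.* (⟦ + (i !) ⟧ ℚ.* ⟦ + ((n ∸ i) !) ⟧))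
        ≡⟨ regroup (oneMinusExpNeg i) (pow oneMinusExpNeg m (n ∸ i)) ⟦ + (n C i) ⟧ ⟦ + (i !) ⟧ ⟦ + ((n ∸ i) !) ⟧ ⟩
      ⟦ + (n C i) ⟧ ℚ.* ((oneMinusExpNeg i ℚ.* ⟦ + (i !) ⟧) ℚ.* (pow oneMinusExpNeg m (n ∸ i) ℚ.* ⟦ + ((n ∸ i) !) ⟧))
        ≡⟨ cong₂ (λ a b → ⟦ + (n C i) ⟧ ℚ.* (a ℚ.* b)) (oneMinusExpNeg-coefficient i) (pow-coefficient m (n ∸ i)) ⟩
      ⟦ + (n C i) ⟧ ℚ.* (⟦ uPow 1 i ⟧ ℚ.* ⟦ uPow m (n ∸ i) ⟧)
        ≡⟨ trans (⟦⟧-* (+ (n C i)) (uPow 1 i * uPow m (n ∸ i))) (cong (⟦ + (n C i) ⟧ ℚ.*_) (⟦⟧-* (uPow 1 i) (uPow m (n ∸ i)))) ⟨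
      ⟦ + (n C i) * (uPow 1 i * uPow m (n ∸ i)) ⟧ ∎

  polyBernoulliNeg≡polyBernoulliℤ : ∀ k n → polyBernoulliNeg k n ≡ ⟦ polyBernoulliℤ k n ⟧
  polyBernoulliNeg≡polyBernoulliℤ k n = begin
    ⟦ + (n !) ⟧ ℚ.* Σ≤ n (λ m → ⟦ + (suc m ℕ.^ k) ⟧ ℚ.* pow oneMinusExpNeg m n)
      ≡⟨ ℚP.*-comm ⟦ + (n !) ⟧ _ ⟩
    Σ≤ n (λ m → ⟦ + (suc m ℕ.^ k) ⟧ ℚ.* pow oneMinusExpNeg m n) ℚ.* ⟦ + (n !) ⟧
      ≡⟨ Σ≤-*ʳ n (λ m → ⟦ + (suc m ℕ.^ k) ⟧ ℚ.* pow oneMinusExpNeg m n) ⟦ + (n !) ⟧ ⟩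
    Σ≤ n (λ m → ⟦ + (suc m ℕ.^ k) ⟧ ℚ.* pow oneMinusExpNeg m n ℚ.* ⟦ + (n !) ⟧)
      ≡⟨ Σ≤-cong n (λ {m} _ → term m) ⟩
    Σ≤ n (λ m → ⟦ (+ suc m) ^ k * uPow m n ⟧)
      ≡⟨ Σ≤-⟦⟧ n (λ m → (+ suc m) ^ k * uPow m n) ⟩
    ⟦ polyBernoulliℤ k n ⟧ ∎
    where
    term : ∀ m → ⟦ + (suc m ℕ.^ k) ⟧ ℚ.* pow oneMinusExpNeg m n ℚ.* ⟦ + (n !) ⟧ ≡ ⟦ (+ suc m) ^ k * uPow m n ⟧
    term m = begin
      ⟦ + (suc m ℕ.^ k) ⟧ ℚ.* pow oneMinusExpNeg m n ℚ.* ⟦ + (n !) ⟧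
        ≡⟨ ℚP.*-assoc ⟦ + (suc m ℕ.^ k) ⟧ _ _ ⟩
      ⟦ + (suc m ℕ.^ k) ⟧ ℚ.* (pow oneMinusExpNeg m n ℚ.* ⟦ + (n !) ⟧)
        ≡⟨ cong (⟦ + (suc m ℕ.^ k) ⟧ ℚ.*_) (pow-coefficient m n) ⟩
      ⟦ + (suc m ℕ.^ k) ⟧ ℚ.* ⟦ uPow m n ⟧
        ≡⟨ ⟦⟧-* (+ (suc m ℕ.^ k)) (uPow m n) ⟨
      ⟦ + (suc m ℕ.^ k) * uPow m n ⟧
        ≡⟨ cong (λ x → ⟦ x * uPow m n ⟧) (pos-^ (suc m) k) ⟩
      ⟦ (+ suc m) ^ k * uPow m n ⟧ ∎

open RationalEmbedding

module Modulo (p : ℕ) where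

  -- A record rather than + p ∣ a - b itself, so that a and b stay inferable.
  infix 4 _≈_
  record _≈_ (a b : ℤ) : Set where
    constructor divides-difference
    field p∣a-b : + p ∣ a - b

  private
    p∣-resp : ∀ {x y} → x ≡ y → + p ∣ x → + p ∣ y
    p∣-resp = subst (+ p ∣_)

  ≈-reflexive : ∀ {a b} → a ≡ b → a ≈ b
  ≈-reflexive {a} refl = divides-difference (divides 0ℤ (ℤP.+-inverseʳ a))

  ≈-refl : ∀ {a} → a ≈ a
  ≈-refl = ≈-reflexive refl

  ≈-sym : ∀ {a b} → a ≈ b → b ≈ a
  ≈-sym {a} {b} (divides-difference d) = divides-difference (p∣-resp (difference a b) (∣m⇒∣-m d))
    where
    difference : ∀ a b → - (a - b) ≡ b - a
    difference = solve-∀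

  ≈-trans : ∀ {a b c} → a ≈ b → b ≈ c → a ≈ c
  ≈-trans {a} {b} {c} (divides-difference d) (divides-difference e) = divides-difference (p∣-resp (difference a b c) (∣m∣n⇒∣m+n d e))
    where
    difference : ∀ a b c → (a - b) + (b - c) ≡ a - c
    difference = solve-∀

  ≈-setoid : Setoid 0ℓ 0ℓ
  ≈-setoid = record { Carrier = ℤ ; _≈_ = _≈_ ; isEquivalence = record { refl = ≈-refl ; sym = ≈-sym ; trans = ≈-trans } }

  +-cong : ∀ {a b c d} → a ≈ b → c ≈ d → a + c ≈ b + d
  +-cong {a} {b} {c} {d} (divides-difference e) (divides-difference f) = divides-difference (p∣-resp (difference a b c d) (∣m∣n⇒∣m+n e f))
    where
    difference : ∀ a b c d → (a - b) + (c - d) ≡ (a + c) - (b + d)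
    difference = solve-∀

  +-congˡ : ∀ c {a b} → a ≈ b → c + a ≈ c + b
  +-congˡ c = +-cong (≈-refl {c})

  +-congʳ : ∀ c {a b} → a ≈ b → a + c ≈ b + c
  +-congʳ c a≈b = +-cong a≈b (≈-refl {c})

  -‿cong : ∀ {a b} → a ≈ b → - a ≈ - b
  -‿cong {a} {b} (divides-difference d) = divides-difference (p∣-resp (difference a b) (∣m⇒∣-m d))
    where
    difference : ∀ a b → - (a - b) ≡ - a - - b
    difference = solve-∀

  *-congˡ : ∀ c {a b} → a ≈ b → c * a ≈ c * b
  *-congˡ c {a} {b} (divides-difference d) = divides-difference (p∣-resp (difference c a b) (∣n⇒∣m*n c d))
    where
    difference : ∀ c a b → c * (a - b) ≡ c * a - c * b
    difference = solve-∀

  *-congʳ : ∀ c {a b} → a ≈ b → a * c ≈ b * c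
  *-congʳ c {a} {b} a≈b = ≈-trans (≈-reflexive (ℤP.*-comm a c)) (≈-trans (*-congˡ c a≈b) (≈-reflexive (ℤP.*-comm c b)))

  *-cong : ∀ {a b c d} → a ≈ b → c ≈ d → a * c ≈ b * d
  *-cong {b = b} {c = c} a≈b c≈d = ≈-trans (*-congʳ c a≈b) (*-congˡ b c≈d)

  ^-congˡ : ∀ e {a b} → a ≈ b → a ^ e ≈ b ^ e
  ^-congˡ zero    _   = ≈-refl
  ^-congˡ (suc e) a≈b = *-cong a≈b (^-congˡ e a≈b)

  p*x≈0 : ∀ x → + p * x ≈ 0ℤ
  p*x≈0 x = divides-difference (divides x (trans (ℤP.+-identityʳ (+ p * x)) (ℤP.*-comm (+ p) x)))

  p≈0 : + p ≈ 0ℤ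
  p≈0 = ≈-trans (≈-reflexive (sym (ℤP.*-identityʳ (+ p)))) (p*x≈0 1ℤ)

  ∑-cong-≈ : ∀ n {f g : ℕ → ℤ} → (∀ {i} → i < n → f i ≈ g i) → ∑ n f ≈ ∑ n g
  ∑-cong-≈ zero    f≈g = ≈-refl
  ∑-cong-≈ (suc n) f≈g = +-cong (f≈g ℕ.z<s) (∑-cong-≈ n (f≈g ∘ ℕ.s<s))

  ∑-vanish : ∀ n {f : ℕ → ℤ} → (∀ {i} → i < n → f i ≈ 0ℤ) → ∑ n f ≈ 0ℤ
  ∑-vanish n f≈0 = ≈-trans (∑-cong-≈ n f≈0) (≈-reflexive (∑-zero n))

  x-y≈0⇒x≈y : ∀ {x y} → x - y ≈ 0ℤ → x ≈ y
  x-y≈0⇒x≈y {x} {y} (divides-difference d) = divides-difference (p∣-resp (ℤP.+-identityʳ (x - y)) d)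

  ≈0⇒multiple : ∀ {a} → a ≈ 0ℤ → ∃ λ z → a ≡ + p * z
  ≈0⇒multiple {a} (divides-difference (divides z eq)) = z , trans (sym (ℤP.+-identityʳ a)) (trans eq (ℤP.*-comm z (+ p)))

module PrimeModulus (p-1 : ℕ) (p-prime : Prime (suc p-1)) where

  p : ℕ
  p = suc p-1

  open Modulo p public
  open SetoidReasoning ≈-setoid

  d*x≈0⇒x≈0 : ∀ {d} x → 0 < d → d < p → + d * x ≈ 0ℤ → x ≈ 0ℤ
  d*x≈0⇒x≈0 {d} x 0<d d<p (divides-difference p∣dx) with euclidsLemma d (ℤ.∣ x ∣) p-prime p∣d*∣x∣
    where
    p∣d*∣x∣ : p ℕDiv.∣ d ℕ.* ℤ.∣ x ∣
    p∣d*∣x∣ = subst (p ℕDiv.∣_) (trans (cong ℤ.∣_∣ (ℤP.+-identityʳ (+ d * x))) (ℤP.abs-* (+ d) x)) (∣⇒∣ᵤ p∣dx)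
  ... | inj₁ p∣d = contradiction (ℕDiv.∣⇒≤ {{ℕ.>-nonZero 0<d}} p∣d) (ℕP.<⇒≱ d<p)
  ... | inj₂ p∣x = divides-difference (subst (+ p ∣_) (sym (ℤP.+-identityʳ x)) (∣ᵤ⇒∣ p∣x))

  pCk≈0 : ∀ {k} → 0 < k → k < p → + (p C k) ≈ 0ℤ
  pCk≈0 {suc k} _ k<p = d*x≈0⇒x≈0 (+ (p C suc k)) ℕ.z<s k<p (begin
    + suc k * + (p C suc k)   ≡⟨ absorption-ℤ p-1 k ⟩
    + p * + (p-1 C k)         ≈⟨ p*x≈0 (+ (p-1 C k)) ⟩
    0ℤ                        ∎)

  a^p≈a : ∀ a → (+ a) ^ p ≈ + a
  a^p≈a zero    = ≈-reflexive (ℤP.*-zeroˡ (0ℤ ^ p-1))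
  a^p≈a (suc a) = begin
    (1ℤ + + a) ^ p
      ≡⟨ binomial-theorem p 1ℤ (+ a) ⟩
    term 0 + ∑[ k < p ] term (suc k)
      ≡⟨ cong (_+_ (term 0)) (∑-last p-1 (term ∘ suc)) ⟩
    term 0 + (∑[ k < p-1 ] term (suc k) + term p)
      ≈⟨ +-congˡ (term 0) (+-congʳ (term p) (∑-vanish p-1 (λ k<p-1 → middle (ℕ.s<s k<p-1)))) ⟩
    term 0 + (0ℤ + term p)
      ≡⟨ cong₂ (λ x y → x + (0ℤ + y)) first last ⟩
    (+ a) ^ p + (0ℤ + 1ℤ)
      ≈⟨ +-congʳ (0ℤ + 1ℤ) (a^p≈a a) ⟩
    + a + 1ℤ
      ≡⟨ ℤP.+-comm (+ a) 1ℤ ⟩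
    + suc a ∎
    where
    term : ℕ → ℤ
    term k = + (p C k) * (1ℤ ^ k * (+ a) ^ (p ∸ k))
    first : term 0 ≡ (+ a) ^ p
    first = trans (ℤP.*-identityˡ _) (ℤP.*-identityˡ _)
    last : term p ≡ 1ℤ
    last rewrite nCn≡1 p | ℕP.n∸n≡0 p | ℤP.^-zeroˡ p = refl
    middle : ∀ {k} → suc k < p → term (suc k) ≈ 0ℤ
    middle {k} k<p = ≈-trans (*-congʳ (1ℤ ^ suc k * (+ a) ^ (p ∸ suc k)) (pCk≈0 ℕ.z<s k<p)) (≈-reflexive (ℤP.*-zeroˡ (1ℤ ^ suc k * (+ a) ^ (p ∸ suc k))))

  a^[p-1]≈1 : ∀ {a} → 0 < a → a < p → (+ a) ^ p-1 ≈ 1ℤ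
  a^[p-1]≈1 {a} 0<a a<p = x-y≈0⇒x≈y (d*x≈0⇒x≈0 ((+ a) ^ p-1 - 1ℤ) 0<a a<p (begin
    + a * ((+ a) ^ p-1 - 1ℤ)   ≡⟨ factor (+ a) ((+ a) ^ p-1) ⟩
    (+ a) ^ p - + a            ≈⟨ +-congʳ (- + a) (a^p≈a a) ⟩
    + a - + a                  ≡⟨ ℤP.+-inverseʳ (+ a) ⟩
    0ℤ                         ∎))
    where
    factor : ∀ a x → a * (x - 1ℤ) ≡ a * x - a
    factor = solve-∀

  p-1Ck≈-1^k : ∀ {k} → k < p → + (p-1 C k) ≈ -1ℤ ^ k
  p-1Ck≈-1^k {zero}  _    = ≈-refl
  p-1Ck≈-1^k {suc k} k<p = begin
    + (p-1 C suc k)                          ≡⟨ cancel (+ (p-1 C k)) (+ (p-1 C suc k)) ⟩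
    (+ (p-1 C k) + + (p-1 C suc k)) - + (p-1 C k) ≡⟨ cong (_- + (p-1 C k)) (pascal-ℤ p-1 k) ⟨
    + (p C suc k) - + (p-1 C k)              ≈⟨ +-cong (pCk≈0 ℕ.z<s k<p) (-‿cong (p-1Ck≈-1^k (ℕP.<-trans (ℕP.n<1+n k) k<p))) ⟩
    0ℤ - -1ℤ ^ k                             ≡⟨ negate (-1ℤ ^ k) ⟩
    -1ℤ ^ suc k                              ∎
    where
    cancel : ∀ a b → b ≡ (a + b) - a
    cancel = solve-∀
    negate : ∀ s → 0ℤ - s ≡ -1ℤ * s
    negate = solve-∀

  -- Up to sign this power sum is uPow (p−1) e, since C(p−1, j) ≡ (−1)ʲ.
  ∑-pow-vanish : ∀ {e} → e < p-1 → ∑[ j < p ] ((+ j) ^ e) ≈ 0ℤ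
  ∑-pow-vanish {e} e<p-1 = begin
    ∑[ j < p ] ((+ j) ^ e)                             ≡⟨ involution (-1ℤ ^ e) (∑[ j < p ] ((+ j) ^ e)) (-1^n*-1^n≡1 e) ⟩
    -1ℤ ^ e * (-1ℤ ^ e * ∑[ j < p ] ((+ j) ^ e))       ≡⟨ cong (-1ℤ ^ e *_) (trans (*-distribˡ-∑ p (-1ℤ ^ e) (λ j → (+ j) ^ e)) (∑-cong p (λ {j} _ → sym (neg-^ (+ j) e)))) ⟩
    -1ℤ ^ e * ∑[ j < p ] ((- + j) ^ e)                 ≈⟨ *-congˡ (-1ℤ ^ e) (∑-cong-≈ p term) ⟨
    -1ℤ ^ e * uPow p-1 e                             ≡⟨ cong (-1ℤ ^ e *_) (uPow-vanish e<p-1) ⟩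
    -1ℤ ^ e * 0ℤ                                     ≡⟨ ℤP.*-zeroʳ (-1ℤ ^ e) ⟩
    0ℤ                                               ∎
    where
    involution : ∀ s x → s * s ≡ 1ℤ → x ≡ s * (s * x)
    involution s x s²≡1 = trans (sym (ℤP.*-identityˡ x)) (trans (cong (_* x) (sym s²≡1)) (ℤP.*-assoc s s x))
    term : ∀ {j} → j < p → + (p-1 C j) * (-1ℤ ^ j * (- + j) ^ e) ≈ (- + j) ^ e
    term {j} j<p = begin
      + (p-1 C j) * (-1ℤ ^ j * (- + j) ^ e)   ≈⟨ *-congʳ (-1ℤ ^ j * (- + j) ^ e) (p-1Ck≈-1^k j<p) ⟩
      -1ℤ ^ j * (-1ℤ ^ j * (- + j) ^ e)       ≡⟨ involution (-1ℤ ^ j) ((- + j) ^ e) (-1^n*-1^n≡1 j) ⟨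
      (- + j) ^ e                             ∎

module OddPrimeModulus (p-3 : ℕ) (p-prime : Prime (3 ℕ.+ p-3)) where

  open PrimeModulus (2 ℕ.+ p-3) p-prime public
  open SetoidReasoning ≈-setoid

  p-2 p-1 : ℕ
  p-2 = suc p-3
  p-1 = suc p-2

  p-1≈-1 : + p-1 ≈ -1ℤ
  p-1≈-1 = x-y≈0⇒x≈y (≈-trans (≈-reflexive (ℤP.+-comm (+ p-1) 1ℤ)) p≈0)

  -- Fermat at a = p − 1 ≡ −1, so no parity argument is needed.
  -1^[p-1]≈1 : -1ℤ ^ p-1 ≈ 1ℤ
  -1^[p-1]≈1 = ≈-trans (^-congˡ p-1 (≈-sym p-1≈-1)) (a^[p-1]≈1 ℕ.z<s (ℕP.n<1+n p-1))

  -1^[p-2]≈-1 : -1ℤ ^ p-2 ≈ -1ℤ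
  -1^[p-2]≈-1 = begin
    -1ℤ ^ p-2                   ≡⟨ double-negation (-1ℤ ^ p-2) ⟩
    -1ℤ * -1ℤ ^ p-1             ≈⟨ *-congˡ -1ℤ -1^[p-1]≈1 ⟩
    -1ℤ * 1ℤ                    ≡⟨⟩
    -1ℤ                         ∎
    where
    double-negation : ∀ s → s ≡ -1ℤ * (-1ℤ * s)
    double-negation = solve-∀

  inv : ℕ → ℤ
  inv a = (+ a) ^ p-2

  a*inv[a]≈1 : ∀ {a} → 0 < a → a < p → + a * inv a ≈ 1ℤ
  a*inv[a]≈1 = a^[p-1]≈1

  a*x≈y⇒x≈inv[a]*y : ∀ {a x y} → 0 < a → a < p → + a * x ≈ y → x ≈ inv a * y
  a*x≈y⇒x≈inv[a]*y {a} {x} {y} 0<a a<p ax≈y = begin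
    x                    ≡⟨ ℤP.*-identityˡ x ⟨
    1ℤ * x               ≈⟨ *-congʳ x (a*inv[a]≈1 0<a a<p) ⟨
    + a * inv a * x      ≡⟨ swap (+ a) (inv a) x ⟩
    inv a * (+ a * x)    ≈⟨ *-congˡ (inv a) ax≈y ⟩
    inv a * y            ∎
    where
    swap : ∀ a b x → a * b * x ≡ b * (a * x)
    swap = solve-∀

  inv^c≈a^e : ∀ {a} c e → 0 < a → a < p → c ℕ.+ e ≡ p-1 → inv a ^ c ≈ (+ a) ^ e
  inv^c≈a^e {a} c e 0<a a<p c+e≡p-1 = begin
    inv a ^ c                              ≡⟨ ℤP.*-identityʳ (inv a ^ c) ⟨
    inv a ^ c * 1ℤ                         ≈⟨ *-congˡ (inv a ^ c) (a^[p-1]≈1 0<a a<p) ⟨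
    inv a ^ c * (+ a) ^ p-1                ≡⟨ cong (λ k → inv a ^ c * (+ a) ^ k) c+e≡p-1 ⟨
    inv a ^ c * (+ a) ^ (c ℕ.+ e)          ≡⟨ cong (inv a ^ c *_) (ℤP.^-distribˡ-+-* (+ a) c e) ⟩
    inv a ^ c * ((+ a) ^ c * (+ a) ^ e)    ≡⟨ regroup ⟩
    (+ a * inv a) ^ c * (+ a) ^ e          ≈⟨ *-congʳ ((+ a) ^ e) (^-congˡ c (a*inv[a]≈1 0<a a<p)) ⟩
    1ℤ ^ c * (+ a) ^ e                     ≡⟨ trans (cong (_* (+ a) ^ e) (ℤP.^-zeroˡ c)) (ℤP.*-identityˡ ((+ a) ^ e)) ⟩
    (+ a) ^ e                              ∎
    where
    regroup : inv a ^ c * ((+ a) ^ c * (+ a) ^ e) ≡ (+ a * inv a) ^ c * (+ a) ^ e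
    regroup = trans (sym (ℤP.*-assoc (inv a ^ c) ((+ a) ^ c) ((+ a) ^ e)))
      (cong (_* (+ a) ^ e) (trans (sym (^-distribʳ-* (inv a) (+ a) c)) (cong (_^ c) (ℤP.*-comm (inv a) (+ a)))))

  inv[p-a]≈-inv[a] : ∀ {a} → a ≤ p → inv (p ∸ a) ≈ - inv a
  inv[p-a]≈-inv[a] {a} a≤p = begin
    (+ (p ∸ a)) ^ p-2          ≈⟨ ^-congˡ p-2 p-a≈-a ⟩
    (- + a) ^ p-2              ≡⟨ neg-^ (+ a) p-2 ⟩
    -1ℤ ^ p-2 * inv a          ≈⟨ *-congʳ (inv a) -1^[p-2]≈-1 ⟩
    -1ℤ * inv a                ≡⟨ ℤP.-1*i≡-i (inv a) ⟩
    - inv a                    ∎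
    where
    p-a≈-a : + (p ∸ a) ≈ - + a
    p-a≈-a = begin
      + (p ∸ a)     ≡⟨ trans (ℤP.m-n≡m⊖n p a) (ℤP.⊖-≥ a≤p) ⟨
      + p - + a     ≈⟨ +-congʳ (- + a) p≈0 ⟩
      0ℤ - + a      ≡⟨ ℤP.+-identityˡ (- + a) ⟩
      - + a         ∎

  -- (−j)^{p−1} ≡ 1 for 0 < j < p, so uPow M (p−1) ≡ uPow M 0 − 1.
  uPow[M,p-1]≈-1 : ∀ {M} → 0 < M → M < p → uPow M p-1 ≈ -1ℤ
  uPow[M,p-1]≈-1 {suc M} _ M<p = begin
    0ℤ + ∑[ j < suc M ] (+ (suc M C suc j) * (-1ℤ ^ suc j * (- + suc j) ^ p-1))
      ≈⟨ +-congˡ 0ℤ (∑-cong-≈ (suc M) term) ⟩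
    0ℤ + ∑[ j < suc M ] (+ (suc M C suc j) * (-1ℤ ^ suc j * 1ℤ))
      ≡⟨ shift (∑[ j < suc M ] (+ (suc M C suc j) * (-1ℤ ^ suc j * 1ℤ))) ⟩
    uPow (suc M) 0 - 1ℤ
      ≡⟨ cong (_- 1ℤ) (uPow-vanish {suc M} {0} ℕ.z<s) ⟩
    -1ℤ ∎
    where
    shift : ∀ x → 0ℤ + x ≡ (1ℤ + x) - 1ℤ
    shift = solve-∀
    term : ∀ {j} → j < suc M → + (suc M C suc j) * (-1ℤ ^ suc j * (- + suc j) ^ p-1) ≈ + (suc M C suc j) * (-1ℤ ^ suc j * 1ℤ)
    term {j} j<M = *-congˡ (+ (suc M C suc j)) (*-congˡ (-1ℤ ^ suc j) (begin
      (- + suc j) ^ p-1              ≡⟨ neg-^ (+ suc j) p-1 ⟩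
      -1ℤ ^ p-1 * (+ suc j) ^ p-1    ≈⟨ *-cong -1^[p-1]≈1 (a^[p-1]≈1 ℕ.z<s (ℕP.≤-<-trans j<M M<p)) ⟩
      1ℤ * 1ℤ                        ≡⟨⟩
      1ℤ                             ∎))

  H : ℕ → ℤ
  H M = ∑[ k < M ] inv (suc k)

  H-suc : ∀ M → H (suc M) ≡ H M + inv (suc M)
  H-suc M = ∑-last M (inv ∘ suc)

  uPow[M,p-2]≈H[M] : ∀ {M} → M < p → uPow M p-2 ≈ H M
  uPow[M,p-2]≈H[M] {zero}  _   = ≈-refl
  uPow[M,p-2]≈H[M] {suc M} M<p = begin
    uPow (suc M) p-2                              ≡⟨ y≡x-[x-y] (uPow M p-2) (uPow (suc M) p-2) ⟩
    uPow M p-2 - (uPow M p-2 - uPow (suc M) p-2)  ≈⟨ +-cong (uPow[M,p-2]≈H[M] (ℕP.<-trans (ℕP.n<1+n M) M<p)) (-‿cong decrement) ⟩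
    H M - inv (suc M) * -1ℤ                       ≡⟨ flip-sign (H M) (inv (suc M)) ⟩
    H M + inv (suc M)                             ≡⟨ H-suc M ⟨
    H (suc M)                                     ∎
    where
    flip-sign : ∀ h i → h - i * -1ℤ ≡ h + i
    flip-sign = solve-∀
    decrement : uPow M p-2 - uPow (suc M) p-2 ≈ inv (suc M) * -1ℤ
    decrement = a*x≈y⇒x≈inv[a]*y ℕ.z<s M<p (≈-trans (≈-reflexive (sym (uPow-derivative M p-2))) (uPow[M,p-1]≈-1 ℕ.z<s M<p))

  H[p-1]≈0 : H p-1 ≈ 0ℤ
  H[p-1]≈0 = ≈-trans (≈-sym (uPow[M,p-2]≈H[M] (ℕP.n<1+n p-1))) (≈-reflexive (uPow-vanish (ℕP.n<1+n p-2)))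

  H-reflect : ∀ {k} → k ≤ p-1 → H (p-1 ∸ k) ≈ H k
  H-reflect {zero}  _       = H[p-1]≈0
  H-reflect {suc k} k<p-1 = begin
    H (p-1 ∸ suc k)                                     ≡⟨ x≡x+y-y (H (p-1 ∸ suc k)) (inv (suc (p-1 ∸ suc k))) ⟩
    H (p-1 ∸ suc k) + inv (suc (p-1 ∸ suc k)) - inv (suc (p-1 ∸ suc k))
                                                        ≡⟨ cong₂ _-_ (sym (H-suc (p-1 ∸ suc k))) refl ⟩
    H (suc (p-1 ∸ suc k)) - inv (suc (p-1 ∸ suc k))     ≡⟨ cong (λ x → H x - inv x) (sym (ℕP.+-∸-assoc 1 k<p-1)) ⟩
    H (p-1 ∸ k) - inv (p ∸ suc k)                       ≈⟨ +-cong (H-reflect (ℕP.<⇒≤ k<p-1)) (-‿cong (inv[p-a]≈-inv[a] (ℕP.m≤n⇒m≤1+n k<p-1))) ⟩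
    H k - - inv (suc k)                                 ≡⟨ flip-sign (H k) (inv (suc k)) ⟩
    H k + inv (suc k)                                   ≡⟨ H-suc k ⟨
    H (suc k)                                           ∎
    where
    flip-sign : ∀ h i → h - - i ≡ h + i
    flip-sign = solve-∀

  uPow[M+1,p-3]≈uPow[M,p-3]-H[M+1]/[M+1] : ∀ {M} → suc M < p → uPow (suc M) p-3 ≈ uPow M p-3 - inv (suc M) * H (suc M)
  uPow[M+1,p-3]≈uPow[M,p-3]-H[M+1]/[M+1] {M} M<p = begin
    uPow (suc M) p-3                              ≡⟨ y≡x-[x-y] (uPow M p-3) (uPow (suc M) p-3) ⟩
    uPow M p-3 - (uPow M p-3 - uPow (suc M) p-3)  ≈⟨ +-congˡ (uPow M p-3) (-‿cong decrement) ⟩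
    uPow M p-3 - inv (suc M) * H (suc M)          ∎
    where
    decrement : uPow M p-3 - uPow (suc M) p-3 ≈ inv (suc M) * H (suc M)
    decrement = a*x≈y⇒x≈inv[a]*y ℕ.z<s M<p (≈-trans (≈-reflexive (sym (uPow-derivative M p-3))) (uPow[M,p-2]≈H[M] M<p))

  factorialStirling[p-3,j]≈±H[j+1]/[j+1] : ∀ {j} → suc j < p → factorialStirling p-3 j ≈ inv (suc j) * (-1ℤ ^ (p-3 ℕ.+ j) * H (suc j))
  factorialStirling[p-3,j]≈±H[j+1]/[j+1] {j} j<p = a*x≈y⇒x≈inv[a]*y ℕ.z<s j<p
    (≈-trans (≈-reflexive (factorialStirling-uPow p-3 j)) (*-congˡ (-1ℤ ^ (p-3 ℕ.+ j)) (uPow[M,p-2]≈H[M] j<p)))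

module DiagonalPolyBernoulli (m : ℕ) (p-prime : Prime (7 ℕ.+ m)) where

  open OddPrimeModulus (4 ℕ.+ m) p-prime public
  open SetoidReasoning ≈-setoid

  n : ℕ
  n = 4 ℕ.+ m

  B : ℤ
  B = polyBernoulliℤ n n

  inv² : ℕ → ℤ
  inv² M = inv M * inv M

  H₂ : ℕ → ℤ
  H₂ M = ∑[ k < M ] inv² (suc k)

  H₂-suc : ∀ M → H₂ (suc M) ≡ H₂ M + inv² (suc M)
  H₂-suc M = ∑-last M (inv² ∘ suc)

  -- ∑₊ f = f 1 + … + f (p − 1). The summands are named by their value modulo p, where 1/M is inv M.
  ∑₊ : (ℕ → ℤ) → ℤ
  ∑₊ f = ∑[ k < p-1 ] f (suc k)

  1/M⁴ H₂/M² H/M³ H²/M² HH₂/M : ℕ → ℤ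
  1/M⁴  M = inv² M * inv² M
  H₂/M² M = H₂ M * inv² M
  H/M³  M = H M * (inv² M * inv M)
  H²/M² M = inv² M * (H M * H M)
  HH₂/M M = inv M * H M * H₂ M

  2<p : 2 < p
  2<p = ℕ.s<s (ℕ.s<s ℕ.z<s)

  3<p : 3 < p
  3<p = ℕ.s<s (ℕ.s<s (ℕ.s<s ℕ.z<s))

  -- 1/M^c ≡ Mᵉ for c + e = p − 1, and the power sum of a positive exponent e < p − 1 vanishes.
  ∑₊1/M^c≈0 : ∀ c e → suc c ℕ.+ suc e ≡ p-1 → ∑₊ (λ M → inv M ^ suc c) ≈ 0ℤ
  ∑₊1/M^c≈0 c e c+e≡p-1 = begin
    ∑₊ (λ M → inv M ^ suc c)
      ≈⟨ ∑-cong-≈ p-1 {λ k → inv (suc k) ^ suc c} {λ k → (+ suc k) ^ suc e} (λ k<p-1 → inv^c≈a^e (suc c) (suc e) ℕ.z<s (ℕ.s<s k<p-1) c+e≡p-1) ⟩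
    ∑₊ (λ M → (+ M) ^ suc e)
      ≡⟨ ℤP.+-identityˡ (∑₊ (λ M → (+ M) ^ suc e)) ⟨
    0ℤ + ∑₊ (λ M → (+ M) ^ suc e)
      ≡⟨ cong (_+ ∑₊ (λ M → (+ M) ^ suc e)) (ℤP.*-zeroˡ (0ℤ ^ e)) ⟨
    ∑[ j < p ] ((+ j) ^ suc e)
      ≈⟨ ∑-pow-vanish (ℕP.m+n≤o⇒n≤o c (ℕP.≤-reflexive (trans (ℕP.+-suc c (suc e)) c+e≡p-1))) ⟩
    0ℤ ∎

  ∑1/M⁴≈0 : ∑₊ 1/M⁴ ≈ 0ℤ
  ∑1/M⁴≈0 = begin
    ∑₊ 1/M⁴                   ≡⟨ ∑-cong p-1 (λ {k} _ → fourth-power (inv (suc k))) ⟩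
    ∑₊ (λ M → inv M ^ 4)      ≈⟨ ∑₊1/M^c≈0 3 (suc m) refl ⟩
    0ℤ                        ∎
    where
    fourth-power : ∀ x → x * x * (x * x) ≡ x * (x * (x * (x * 1ℤ)))
    fourth-power = solve-∀

  H₂[p-1]≈0 : H₂ p-1 ≈ 0ℤ
  H₂[p-1]≈0 = begin
    H₂ p-1                    ≡⟨ ∑-cong p-1 (λ {k} _ → square (inv (suc k))) ⟩
    ∑₊ (λ M → inv M ^ 2)      ≈⟨ ∑₊1/M^c≈0 1 (3 ℕ.+ m) refl ⟩
    0ℤ                        ∎
    where
    square : ∀ x → x * x ≡ x * (x * 1ℤ)
    square = solve-∀

  -- 2 ∑₊ H₂/M² − ∑₊ 1/M⁴ telescopes to H₂(p−1)².
  ∑H₂/M²≈0 : ∑₊ H₂/M² ≈ 0ℤ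
  ∑H₂/M²≈0 = d*x≈0⇒x≈0 (∑₊ H₂/M²) ℕ.z<s 2<p (begin
    + 2 * ∑₊ H₂/M²                                ≡⟨ split (+ 2 * ∑₊ H₂/M²) (∑₊ 1/M⁴) ⟩
    (+ 2 * ∑₊ H₂/M² - ∑₊ 1/M⁴) + ∑₊ 1/M⁴          ≈⟨ +-congʳ (∑₊ 1/M⁴) telescoped ⟩
    (H₂ p-1 * H₂ p-1 - 0ℤ) + ∑₊ 1/M⁴              ≈⟨ +-cong (+-congʳ (- 0ℤ) (*-cong H₂[p-1]≈0 H₂[p-1]≈0)) ∑1/M⁴≈0 ⟩
    (0ℤ * 0ℤ - 0ℤ) + 0ℤ                           ≡⟨⟩
    0ℤ                                            ∎)
    where
    split : ∀ a b → a ≡ (a - b) + b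
    split = solve-∀
    Δ : ∀ y i → (y + i) * (y + i) - y * y ≡ + 2 * ((y + i) * i) - i * i
    Δ = solve-∀
    increment : ∀ k → + 2 * H₂/M² (suc k) - 1/M⁴ (suc k) ≡ H₂ (suc k) * H₂ (suc k) - H₂ k * H₂ k
    increment k = trans (cong (λ y → + 2 * (y * inv² (suc k)) - 1/M⁴ (suc k)) (H₂-suc k))
                 (trans (sym (Δ (H₂ k) (inv² (suc k)))) (cong (λ y → y * y - H₂ k * H₂ k) (sym (H₂-suc k))))
    telescoped : + 2 * ∑₊ H₂/M² - ∑₊ 1/M⁴ ≈ H₂ p-1 * H₂ p-1 - 0ℤ
    telescoped = begin
      + 2 * ∑₊ H₂/M² - ∑₊ 1/M⁴
        ≡⟨ cong (_- ∑₊ 1/M⁴) (*-distribˡ-∑ p-1 (+ 2) (H₂/M² ∘ suc)) ⟩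
      ∑[ k < p-1 ] (+ 2 * H₂/M² (suc k)) - ∑₊ 1/M⁴
        ≡⟨ ∑-distrib-- p-1 (λ k → + 2 * H₂/M² (suc k)) (1/M⁴ ∘ suc) ⟨
      ∑[ k < p-1 ] (+ 2 * H₂/M² (suc k) - 1/M⁴ (suc k))
        ≡⟨ ∑-cong p-1 (λ {k} _ → increment k) ⟩
      ∑[ k < p-1 ] (H₂ (suc k) * H₂ (suc k) - H₂ k * H₂ k)
        ≡⟨ ∑-telescope p-1 (λ k → H₂ k * H₂ k) ⟩
      H₂ p-1 * H₂ p-1 - 0ℤ ∎

  -- M ↦ p − M turns H(M)/M³ into −H(M−1)/M³, as H(p−1−k) ≡ H k and 1/(p−M) ≡ −1/M.
  ∑H/M³≈0 : ∑₊ H/M³ ≈ 0ℤ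
  ∑H/M³≈0 = d*x≈0⇒x≈0 (∑₊ H/M³) ℕ.z<s 2<p (begin
    + 2 * ∑₊ H/M³                                             ≡⟨ double (∑₊ H/M³) ⟩
    ∑₊ H/M³ + ∑₊ H/M³                                         ≡⟨ cong (_+_ (∑₊ H/M³)) (∑-reverse p-1 (H/M³ ∘ suc)) ⟩
    ∑₊ H/M³ + ∑[ k < p-1 ] H/M³ (suc (p-1 ∸ suc k))           ≈⟨ +-congˡ (∑₊ H/M³) (∑-cong-≈ p-1 {λ k → H/M³ (suc (p-1 ∸ suc k))} {λ k → - H/M³ (suc k) + 1/M⁴ (suc k)} reflected) ⟩
    ∑₊ H/M³ + ∑[ k < p-1 ] (- H/M³ (suc k) + 1/M⁴ (suc k))    ≡⟨ cong (_+_ (∑₊ H/M³)) (∑-distrib-+ p-1 (λ k → - H/M³ (suc k)) (1/M⁴ ∘ suc)) ⟩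
    ∑₊ H/M³ + (∑[ k < p-1 ] (- H/M³ (suc k)) + ∑₊ 1/M⁴)       ≡⟨ cong (λ x → ∑₊ H/M³ + (x + ∑₊ 1/M⁴)) (neg-distrib-∑ p-1 (H/M³ ∘ suc)) ⟨
    ∑₊ H/M³ + (- ∑₊ H/M³ + ∑₊ 1/M⁴)                           ≡⟨ cancel (∑₊ H/M³) (∑₊ 1/M⁴) ⟩
    ∑₊ 1/M⁴                                                   ≈⟨ ∑1/M⁴≈0 ⟩
    0ℤ                                                        ∎)
    where
    double : ∀ x → + 2 * x ≡ x + x
    double = solve-∀
    cancel : ∀ x y → x + (- x + y) ≡ y
    cancel = solve-∀
    expand : ∀ h i → h * (- i * - i * - i) ≡ - ((h + i) * (i * i * i)) + i * i * (i * i)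
    expand = solve-∀
    reflected : ∀ {k} → k < p-1 → H/M³ (suc (p-1 ∸ suc k)) ≈ - H/M³ (suc k) + 1/M⁴ (suc k)
    reflected {k} k<p-1 = begin
      H/M³ (suc (p-1 ∸ suc k))
        ≡⟨ cong H/M³ (ℕP.+-∸-assoc 1 k<p-1) ⟨
      H (p-1 ∸ k) * (inv (p ∸ suc k) * inv (p ∸ suc k) * inv (p ∸ suc k))
        ≈⟨ *-cong (H-reflect (ℕP.<⇒≤ k<p-1)) (*-cong (*-cong i≈ i≈) i≈) ⟩
      H k * (- inv (suc k) * - inv (suc k) * - inv (suc k))
        ≡⟨ expand (H k) (inv (suc k)) ⟩
      - ((H k + inv (suc k)) * (inv² (suc k) * inv (suc k))) + 1/M⁴ (suc k)
        ≡⟨ cong (λ h → - (h * (inv² (suc k) * inv (suc k))) + 1/M⁴ (suc k)) (H-suc k) ⟨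
      - H/M³ (suc k) + 1/M⁴ (suc k) ∎
      where
      i≈ : inv (p ∸ suc k) ≈ - inv (suc k)
      i≈ = inv[p-a]≈-inv[a] (ℕP.<⇒≤ (ℕ.s<s k<p-1))

  M^n≈1/M² : ∀ {M} → 0 < M → M < p → (+ M) ^ n ≈ inv² M
  M^n≈1/M² {M} 0<M M<p = ≈-trans (≈-sym (inv^c≈a^e 2 n 0<M M<p refl)) (≈-reflexive (cong (inv M *_) (ℤP.*-identityʳ (inv M))))

  B≈∑uPow/M² : B ≈ ∑[ k < p-1 ] (inv² (suc k) * uPow k n)
  B≈∑uPow/M² = begin
    B                                          ≡⟨ ∑-last-zero (suc n) g top ⟨
    ∑[ k < p-1 ] g k                           ≈⟨ ∑-cong-≈ p-1 {g} {λ k → inv² (suc k) * uPow k n} (λ {k} k<p-1 → *-congʳ (uPow k n) (M^n≈1/M² ℕ.z<s (ℕ.s<s k<p-1))) ⟩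
    ∑[ k < p-1 ] (inv² (suc k) * uPow k n)     ∎
    where
    g : ℕ → ℤ
    g k = (+ suc k) ^ n * uPow k n
    top : g (suc n) ≡ 0ℤ
    top = trans (cong ((+ suc (suc n)) ^ n *_) (uPow-vanish (ℕP.n<1+n n))) (ℤP.*-zeroʳ ((+ suc (suc n)) ^ n))

  -- Summation by parts against H₂, using uPow (M+1) n ≡ uPow M n − H(M+1)/(M+1).
  ∑uPow/M²≈∑HH₂/M : ∑[ k < p-1 ] (inv² (suc k) * uPow k n) ≈ ∑₊ HH₂/M
  ∑uPow/M²≈∑HH₂/M = begin
    ∑[ k < p-1 ] (inv² (suc k) * E k)
      ≡⟨ split (∑[ k < p-1 ] (inv² (suc k) * E k)) (∑₊ HH₂/M) ⟩
    ∑[ k < p-1 ] (inv² (suc k) * E k) - ∑₊ HH₂/M + ∑₊ HH₂/M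
      ≡⟨ cong (_+ ∑₊ HH₂/M) (∑-distrib-- p-1 (λ k → inv² (suc k) * E k) (HH₂/M ∘ suc)) ⟨
    ∑[ k < p-1 ] (inv² (suc k) * E k - HH₂/M (suc k)) + ∑₊ HH₂/M
      ≈⟨ +-congʳ (∑₊ HH₂/M) (∑-cong-≈ p-1 {λ k → E (suc k) * H₂ (suc k) - E k * H₂ k} {λ k → inv² (suc k) * E k - HH₂/M (suc k)} by-parts) ⟨
    ∑[ k < p-1 ] (E (suc k) * H₂ (suc k) - E k * H₂ k) + ∑₊ HH₂/M
      ≡⟨ cong (_+ ∑₊ HH₂/M) (∑-telescope p-1 (λ k → E k * H₂ k)) ⟩
    E p-1 * H₂ p-1 - E 0 * 0ℤ + ∑₊ HH₂/M
      ≡⟨ cong (λ e → e * H₂ p-1 - E 0 * 0ℤ + ∑₊ HH₂/M) (uPow-vanish (ℕP.m≤n⇒m≤1+n (ℕP.n<1+n n))) ⟩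
    0ℤ * H₂ p-1 - E 0 * 0ℤ + ∑₊ HH₂/M
      ≡⟨ vanish (H₂ p-1) (E 0) (∑₊ HH₂/M) ⟩
    ∑₊ HH₂/M ∎
    where
    E : ℕ → ℤ
    E k = uPow k n
    split : ∀ a b → a ≡ a - b + b
    split = solve-∀
    vanish : ∀ a b c → 0ℤ * a - b * 0ℤ + c ≡ c
    vanish = solve-∀
    expand : ∀ x i h y → (x - i * h) * (y + i * i) - x * y ≡ i * i * x - i * h * (y + i * i)
    expand = solve-∀
    by-parts : ∀ {k} → k < p-1 → E (suc k) * H₂ (suc k) - E k * H₂ k ≈ inv² (suc k) * E k - HH₂/M (suc k)
    by-parts {k} k<p-1 = begin
      E (suc k) * H₂ (suc k) - E k * H₂ k
        ≈⟨ +-congʳ (- (E k * H₂ k)) (*-congʳ (H₂ (suc k)) (uPow[M+1,p-3]≈uPow[M,p-3]-H[M+1]/[M+1] (ℕ.s<s k<p-1))) ⟩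
      (E k - inv (suc k) * H (suc k)) * H₂ (suc k) - E k * H₂ k
        ≡⟨ cong (λ y → (E k - inv (suc k) * H (suc k)) * y - E k * H₂ k) (H₂-suc k) ⟩
      (E k - inv (suc k) * H (suc k)) * (H₂ k + inv² (suc k)) - E k * H₂ k
        ≡⟨ expand (E k) (inv (suc k)) (H (suc k)) (H₂ k) ⟩
      inv² (suc k) * E k - inv (suc k) * H (suc k) * (H₂ k + inv² (suc k))
        ≡⟨ cong (λ y → inv² (suc k) * E k - inv (suc k) * H (suc k) * y) (H₂-suc k) ⟨
      inv² (suc k) * E k - HH₂/M (suc k) ∎

  B≈∑H²/M² : B ≈ ∑₊ H²/M²
  B≈∑H²/M² = begin
    B
      ≡⟨ polyBernoulliℤ-closedForm n n ⟩
    ∑[ j < suc n ] (factorialStirling n j * factorialStirling n j)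
      ≈⟨ ∑-cong-≈ (suc n) {λ j → factorialStirling n j * factorialStirling n j} {H²/M² ∘ suc} square ⟩
    ∑ (suc n) (H²/M² ∘ suc)
      ≡⟨ ℤP.+-identityʳ (∑ (suc n) (H²/M² ∘ suc)) ⟨
    ∑ (suc n) (H²/M² ∘ suc) + 0ℤ
      ≈⟨ +-congˡ (∑ (suc n) (H²/M² ∘ suc)) (≈-trans (*-congˡ (inv² p-1) (*-cong H[p-1]≈0 H[p-1]≈0)) (≈-reflexive (ℤP.*-zeroʳ (inv² p-1)))) ⟨
    ∑ (suc n) (H²/M² ∘ suc) + H²/M² p-1
      ≡⟨ ∑-last (suc n) (H²/M² ∘ suc) ⟨
    ∑₊ H²/M² ∎
    where
    unsign : ∀ i s h → s * s ≡ 1ℤ → i * (s * h) * (i * (s * h)) ≡ i * i * (h * h)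
    unsign i s h s²≡1 = trans (regroup i s h) (trans (cong (_* (i * i * (h * h))) s²≡1) (ℤP.*-identityˡ (i * i * (h * h))))
      where
      regroup : ∀ i s h → i * (s * h) * (i * (s * h)) ≡ s * s * (i * i * (h * h))
      regroup = solve-∀
    square : ∀ {j} → j < suc n → factorialStirling n j * factorialStirling n j ≈ H²/M² (suc j)
    square {j} j<n = begin
      factorialStirling n j * factorialStirling n j
        ≈⟨ *-cong (factorialStirling[p-3,j]≈±H[j+1]/[j+1] j<p) (factorialStirling[p-3,j]≈±H[j+1]/[j+1] j<p) ⟩
      inv (suc j) * (-1ℤ ^ (n ℕ.+ j) * H (suc j)) * (inv (suc j) * (-1ℤ ^ (n ℕ.+ j) * H (suc j)))
        ≡⟨ unsign (inv (suc j)) (-1ℤ ^ (n ℕ.+ j)) (H (suc j)) (-1^n*-1^n≡1 (n ℕ.+ j)) ⟩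
      H²/M² (suc j) ∎
      where
      j<p : suc j < p
      j<p = ℕP.m<n⇒m<1+n (ℕ.s<s j<n)

  H²H₂ : ℕ → ℤ
  H²H₂ M = H M * H M * H₂ M

  H²H₂-increment : ∀ k → H²H₂ (suc k) - H²H₂ k
                       ≡ H²/M² (suc k) + + 2 * HH₂/M (suc k) - (+ 2 * H/M³ (suc k) + H₂/M² (suc k) - 1/M⁴ (suc k))
  H²H₂-increment k = trans (cong₂ (λ h h₂ → H²H₂ (suc k) - h * h * h₂) (previous (H k) (inv (suc k)) (H-suc k)) (previous (H₂ k) (inv² (suc k)) (H₂-suc k)))
                           (expand (H (suc k)) (inv (suc k)) (H₂ (suc k)))
    where
    previous : ∀ x i {y} → y ≡ x + i → x ≡ y - i
    previous x i refl = x≡x+y-y x i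
    expand : ∀ x i y → x * x * y - (x - i) * (x - i) * (y - i * i)
                     ≡ i * i * (x * x) + + 2 * (i * x * y) - (+ 2 * (x * (i * i * i)) + y * (i * i) - i * i * (i * i))
    expand = solve-∀

  ∑H²/M²+2∑HH₂/M≈0 : ∑₊ H²/M² + + 2 * ∑₊ HH₂/M ≈ 0ℤ
  ∑H²/M²+2∑HH₂/M≈0 = begin
    ∑₊ H²/M² + + 2 * ∑₊ HH₂/M                       ≡⟨ split (∑₊ H²/M² + + 2 * ∑₊ HH₂/M) lower ⟩
    ∑₊ H²/M² + + 2 * ∑₊ HH₂/M - lower + lower       ≈⟨ +-cong telescoped lower≈0 ⟩
    0ℤ + 0ℤ                                         ≡⟨⟩
    0ℤ                                              ∎
    where
    split : ∀ a b → a ≡ a - b + b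
    split = solve-∀
    lower : ℤ
    lower = + 2 * ∑₊ H/M³ + ∑₊ H₂/M² - ∑₊ 1/M⁴
    lower≈0 : lower ≈ 0ℤ
    lower≈0 = +-cong (+-cong (*-congˡ (+ 2) ∑H/M³≈0) ∑H₂/M²≈0) (-‿cong ∑1/M⁴≈0)
    linearity : ∑₊ H²/M² + + 2 * ∑₊ HH₂/M - lower
              ≈ ∑[ k < p-1 ] (H²/M² (suc k) + + 2 * HH₂/M (suc k) - (+ 2 * H/M³ (suc k) + H₂/M² (suc k) - 1/M⁴ (suc k)))
    linearity = begin
      ∑₊ H²/M² + + 2 * ∑₊ HH₂/M - (+ 2 * ∑₊ H/M³ + ∑₊ H₂/M² - ∑₊ 1/M⁴)
        ≡⟨ cong₂ (λ x y → ∑₊ H²/M² + x - (y + ∑₊ H₂/M² - ∑₊ 1/M⁴)) (*-distribˡ-∑ p-1 (+ 2) (HH₂/M ∘ suc)) (*-distribˡ-∑ p-1 (+ 2) (H/M³ ∘ suc)) ⟩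
      ∑₊ H²/M² + ∑[ k < p-1 ] (+ 2 * HH₂/M (suc k)) - (∑[ k < p-1 ] (+ 2 * H/M³ (suc k)) + ∑₊ H₂/M² - ∑₊ 1/M⁴)
        ≡⟨ cong₂ (λ x y → x - (y - ∑₊ 1/M⁴)) (∑-distrib-+ p-1 (H²/M² ∘ suc) (λ k → + 2 * HH₂/M (suc k))) (∑-distrib-+ p-1 (λ k → + 2 * H/M³ (suc k)) (H₂/M² ∘ suc)) ⟨
      ∑[ k < p-1 ] (H²/M² (suc k) + + 2 * HH₂/M (suc k)) - (∑[ k < p-1 ] (+ 2 * H/M³ (suc k) + H₂/M² (suc k)) - ∑₊ 1/M⁴)
        ≡⟨ cong (_-_ (∑[ k < p-1 ] (H²/M² (suc k) + + 2 * HH₂/M (suc k)))) (∑-distrib-- p-1 (λ k → + 2 * H/M³ (suc k) + H₂/M² (suc k)) (1/M⁴ ∘ suc)) ⟨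
      ∑[ k < p-1 ] (H²/M² (suc k) + + 2 * HH₂/M (suc k)) - ∑[ k < p-1 ] (+ 2 * H/M³ (suc k) + H₂/M² (suc k) - 1/M⁴ (suc k))
        ≡⟨ ∑-distrib-- p-1 (λ k → H²/M² (suc k) + + 2 * HH₂/M (suc k)) (λ k → + 2 * H/M³ (suc k) + H₂/M² (suc k) - 1/M⁴ (suc k)) ⟨
      ∑[ k < p-1 ] (H²/M² (suc k) + + 2 * HH₂/M (suc k) - (+ 2 * H/M³ (suc k) + H₂/M² (suc k) - 1/M⁴ (suc k))) ∎
    telescoped : ∑₊ H²/M² + + 2 * ∑₊ HH₂/M - lower ≈ 0ℤ
    telescoped = begin
      ∑₊ H²/M² + + 2 * ∑₊ HH₂/M - lower                ≈⟨ linearity ⟩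
      ∑[ k < p-1 ] (H²/M² (suc k) + + 2 * HH₂/M (suc k) - (+ 2 * H/M³ (suc k) + H₂/M² (suc k) - 1/M⁴ (suc k)))
                                                        ≡⟨ ∑-cong p-1 (λ {k} _ → H²H₂-increment k) ⟨
      ∑[ k < p-1 ] (H²H₂ (suc k) - H²H₂ k)              ≡⟨ ∑-telescope p-1 H²H₂ ⟩
      H²H₂ p-1 - 0ℤ                                     ≈⟨ +-congʳ (- 0ℤ) (*-cong (*-cong H[p-1]≈0 H[p-1]≈0) H₂[p-1]≈0) ⟩
      0ℤ * 0ℤ * 0ℤ - 0ℤ                                 ≡⟨⟩
      0ℤ                                                ∎

  B≈0 : B ≈ 0ℤ
  B≈0 = d*x≈0⇒x≈0 B ℕ.z<s 3<p (begin
    + 3 * B                        ≡⟨ triple B ⟩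
    B + + 2 * B                    ≈⟨ +-cong B≈∑H²/M² (*-congˡ (+ 2) (≈-trans B≈∑uPow/M² ∑uPow/M²≈∑HH₂/M)) ⟩
    ∑₊ H²/M² + + 2 * ∑₊ HH₂/M      ≈⟨ ∑H²/M²+2∑HH₂/M≈0 ⟩
    0ℤ                             ∎)
    where
    triple : ∀ b → + 3 * b ≡ b + + 2 * b
    triple = solve-∀

theorem3p5 : (p : ℕ) → Prime p → 7 ≤ p →
    ∃ λ (z : ℤ) → polyBernoulliNeg (p ∸ 3) (p ∸ 3) ≡ (((+ p) * z) / 1)
theorem3p5 p p-prime 7≤p with ℕP.m≤n⇒∃[o]m+o≡n 7≤p
... | m , refl = proj₁ multiple , trans (polyBernoulliNeg≡polyBernoulliℤ (4 ℕ.+ m) (4 ℕ.+ m)) (cong ⟦_⟧ (proj₂ multiple))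
  where
  multiple : ∃ λ z → polyBernoulliℤ (4 ℕ.+ m) (4 ℕ.+ m) ≡ + (7 ℕ.+ m) * z
  multiple = DiagonalPolyBernoulli.≈0⇒multiple m p-prime (DiagonalPolyBernoulli.B≈0 m p-prime)
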